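{- Let $\mathcal{S}\subset\mathbb{Z}$ with $\max\mathcal{S}=1$. For any prescribed type distribution, the number of non-negative $\mathcal{S}$-embedded Cayley trees having this type distribution equals $$\frac{1}{n_r}\,\frac{n!}{\prod_{i=0}^r(n_i-1)!}$$ times the number of marked $\mathcal{S}$-trees on $V=\bigcup_{i=0}^rV_i$, $V_i=\{i^1,\ldots,i^{n_i}\}$, rooted at $0^1$, satisfying condition (T) and having the same type distribution; here $(n_0,\ldots,n_r)$ is the profile and $n=\sum_i n_i$ the size.
   Context: An $\mathcal{S}$-embedded Cayley tree is a tree on vertex set $\{1,\ldots,n\}$ with a distinguished root, together with abscissas $a(v)\in\mathbb{Z}$, root at abscissa $0$, with $a(v')-a(v)\in\mathcal{S}$ whenever $v'$ is a child of $v$; it is non-negative if all abscissas are $\ge0$, and its profile is $(n_0,\ldots,n_r)$ with $n_i$ the number of vertices at abscissa $i$, $r$ the maximal abscissa. Let $m=\min\mathcal{S}$. The type of a non-root vertex $v$ is $(i;s;\mathbf{c})$ where $i=a(v)$, $i-s$ is the abscissa of its parent, and $\mathbf{c}=(c^m,\ldots,c^1)$ with $c^k$ the number of children at abscissa $i+k$ (for the root, $s=\varepsilon$). The type distribution is the collection of numbers of vertices of each type. On $V$, vertex $i^k$ has abscissa $i$. An $\mathcal{S}$-tree is a rooted tree on $V$ in which the parent of every non-root vertex of $V_i$ lies in $\bigcup_{s\in\mathcal{S}}V_{i-s}$; types are defined in the same way via the parent. A marked $\mathcal{S}$-tree is a pair $(T,r^q)$ with $r^q\in V_r$. Condition (T):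 for every $i\in\{1,\ldots,r\}$, on the path from $r^q$ to $0^1$, the first vertex of $V_{i-1}$ is immediately preceded by $i^1$. -}

module Defs where

open import Data.Nat as ℕ using (ℕ; zero; suc; _∸_; _≤_; _+_)
open import Data.Integer as ℤ using (ℤ; +_)
open import Data.Fin as Fin using (Fin; toℕ)
open import Data.Bool using (Bool; true; false; if_then_else_; not; _∧_)
open import Data.Maybe using (Maybe; just; nothing)
open import Data.Product using (Σ; _×_; _,_; proj₁)
open import Data.List as List using (List; []; _∷_; length)
open import Data.List.Membership.Propositional using (_∈_)
open import Data.List.Relation.Unary.Unique.Propositional using (Unique)
open import Data.Vec as Vec using (Vec)
open import Function.Bundles using (_⇔_)
open import Relation.Nullary using (¬_; ⌊_⌋)
open import Relation.Binary.PropositionalEquality using (_≡_)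
open import Relation.Binary.Definitions using (DecidableEquality)
import Data.Product.Properties as ×P
import Data.Maybe.Properties as MaybeP
import Data.Vec.Properties as VecP

countF : ∀ {N} → (Fin N → Bool) → ℕ
countF {zero}  p = 0
countF {suc N} p = (if p Fin.zero then 1 else 0) + countF (λ v → p (Fin.suc v))


HasCard : ∀ {A : Set} → (A → Set) → ℕ → Set
HasCard {A} P k =
  Σ (List A) λ xs → Unique xs × (∀ x → (x ∈ xs) ⇔ P x) × length xs ≡ k

iter : ∀ {A : Set} → (A → A) → ℕ → A → A
iter f zero    x = x
iter f (suc k) x = f (iter f k x)

prodV : ∀ {k} → Vec ℕ k → ℕ
prodV = Vec.foldr _ ℕ._*_ 1

-- The step set S ⊆ ℤ is a predicate; m = min S.
-- Width of the child-count vector c = (c^m, …, c^1): 1 - m + 1 entries.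

width : ℤ → ℕ
width m = suc ℤ.∣ + 1 ℤ.- m ∣

-- Type of a vertex: (abscissa i ; step s, or nothing = ε for the root ;
-- c = (c^m, …, c^1)), where entry j of c is c^(m + j).
VType : ℤ → Set
VType m = ℕ × Maybe ℤ × Vec ℕ (width m)

_≟T_ : ∀ {m} → DecidableEquality (VType m)
_≟T_ = ×P.≡-dec ℕ._≟_ (×P.≡-dec (MaybeP.≡-dec ℤ._≟_) (VecP.≡-dec ℕ._≟_))

-- Rooted trees given by a parent map (the root is its own parent,
-- by convention) together with an abscissa map a : Fin N → ℕ.

module Tree {N : ℕ} (ρ : Fin N) (par : Fin N → Fin N) (a : Fin N → ℕ) where

  IsRootedTree : Set
  IsRootedTree = par ρ ≡ ρ × (∀ v → iter par N v ≡ ρ)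

  StepsIn : (ℤ → Set) → Set
  StepsIn S = ∀ v → ¬ (v ≡ ρ) → S (+ a v ℤ.- + a (par v))

  childrenAt : Fin N → ℤ → ℕ
  childrenAt v k = countF λ w →
    not ⌊ w Fin.≟ ρ ⌋
      ∧ (⌊ par w Fin.≟ v ⌋
      ∧ ⌊ + a w ℤ.≟ + a v ℤ.+ k ⌋)

  typeOf : (m : ℤ) → Fin N → VType m
  typeOf m v =
    ( a v
    , (if ⌊ v Fin.≟ ρ ⌋ then nothing else just (+ a v ℤ.- + a (par v)))
    , Vec.tabulate (λ j → childrenAt v (m ℤ.+ + toℕ j)) )

  HasTypeDist : (m : ℤ) → (VType m → ℕ) → Set
  HasTypeDist m D = ∀ t → countF (λ v → ⌊ _≟T_ {m} (typeOf m v) t ⌋) ≡ D t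

-- Raw data: (root, parent vector, abscissa vector); abscissas are ℕ
-- because the tree is non-negative.

RawCayley : ℕ → Set
RawCayley n = Fin n × Vec (Fin n) n × Vec ℕ n

IsCayley : (S : ℤ → Set) (m : ℤ) (r : ℕ) (ns : Vec ℕ (suc r))
           (D : VType m → ℕ) → RawCayley (Vec.sum ns) → Set
IsCayley S m r ns D (ρ , pv , av) =
  IsRootedTree × a ρ ≡ 0 × StepsIn S
  × (∀ v → a v ≤ r)
  × (∀ (i : Fin (suc r)) → countF (λ v → ⌊ a v ℕ.≟ toℕ i ⌋) ≡ Vec.lookup ns i)
  × HasTypeDist m D
  where
    a = Vec.lookup av
    open Tree ρ (Vec.lookup pv) a

-- The vertex set V = ⋃ V_i, V_i = {i^1,…,i^{n_i}}, listed level by level;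
-- a vertex is an index into this list, its label (i , j) stands for i^j.

Vlist : ∀ {r} → Vec ℕ (suc r) → List (ℕ × ℕ)
Vlist {r} ns = List.concatMap
  (λ i → List.map (λ j → (toℕ i , suc j)) (List.upTo (Vec.lookup ns i)))
  (List.allFin (suc r))

Vsize : ∀ {r} → Vec ℕ (suc r) → ℕ
Vsize ns = length (Vlist ns)

label : ∀ {r} (ns : Vec ℕ (suc r)) → Fin (Vsize ns) → ℕ × ℕ
label ns = List.lookup (Vlist ns)

level : ∀ {r} (ns : Vec ℕ (suc r)) → Fin (Vsize ns) → ℕ
level ns v = proj₁ (label ns v)

pathTo : ∀ {N} → Fin N → (Fin N → Fin N) → ℕ → Fin N → List (Fin N)
pathTo ρ par zero    x = x ∷ []
pathTo ρ par (suc k) x =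
  if ⌊ x Fin.≟ ρ ⌋ then x ∷ [] else x ∷ pathTo ρ par k (par x)

-- along a list, the element immediately preceding the first element
-- whose level is ℓ (if that first element is not the head)
predOfFirst : ∀ {N} → (Fin N → ℕ) → ℕ → List (Fin N) → Maybe (Fin N)
predOfFirst lv ℓ (x ∷ y ∷ rest) =
  if ⌊ lv y ℕ.≟ ℓ ⌋ then just x else predOfFirst lv ℓ (y ∷ rest)
predOfFirst lv ℓ _ = nothing

-- Marked S-trees on V rooted at 0^1 with mark r^q ∈ V_r, satisfying
-- condition (T), with type distribution D.
-- Raw data: (root, parent vector, marked vertex).
RawMarked : ℕ → Set
RawMarked N = Fin N × Vec (Fin N) N × Fin N

IsMarkedT : (S : ℤ → Set) (m : ℤ) (r : ℕ) (ns : Vec ℕ (suc r))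
            (D : VType m → ℕ) → RawMarked (Vsize ns) → Set
IsMarkedT S m r ns D (ρ , pv , q) =
  label ns ρ ≡ (0 , 1) × IsRootedTree × StepsIn S
  × level ns q ≡ r
  × CondT
  × HasTypeDist m D
  where
    par = Vec.lookup pv
    open Tree ρ par (level ns)
    -- condition (T): for each i ∈ {1..r}, on the path from r^q to 0^1
    -- the first vertex of V_{i-1} is immediately preceded by i^1
    CondT : Set
    CondT = ∀ (i : ℕ) → 1 ≤ i → i ≤ r →
      Σ (Fin (Vsize ns)) λ u →
        predOfFirst (level ns) (i ∸ 1) (pathTo ρ par (Vsize ns) q) ≡ just u
        × label ns u ≡ (i , 1)

module Submission where

-- Write n = n₀ + … + n_r and V = V₀ ∪ … ∪ V_r (so |V| = n). For a Cayley
-- tree T, a vertex q of T at the top abscissa r distinguishes one vertex per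
-- abscissa: the root at abscissa 0 and, at abscissa i ≥ 1, the vertex that
-- immediately precedes the first vertex of abscissa i-1 on the path from q to
-- the root (it exists because max S = 1: towards the root the abscissa drops by
-- at most one per step). We count two sets:
--   A = triples (T, q, σ), σ : {1..n} ↪ V sending every vertex of abscissa i
--       into V_i, the distinguished ones onto i^1 and the others off i^1;
--   B = pairs (T', τ), T' a marked S-tree on V with (T), τ : {1..n} ↪ V.
-- Both are instances of one counting lemma: colour-preserving injections
-- between two sets with equal colour class sizes m_c number ∏ m_c!. Hence
-- |A| = k₁ · n_r · ∏ (n_i - 1)! and |B| = k₂ · n!. Transporting the tree
-- structure along σ (resp. τ⁻¹) is a bijection A ≅ B: condition (T) says
-- exactly that the distinguished vertices are sent to the vertices i^1.

module Counting where
  open import Data.Nat as ℕ using (ℕ; zero; suc; _+_; _*_; _∸_; _≤_; _<_; z≤n; s≤s; _!)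
  import Data.Nat.Properties as ℕP
  open import Data.Integer as ℤ using (ℤ)
  import Data.Integer.Properties as ℤP
  open import Data.Fin as Fin using (Fin; zero; suc; toℕ; punchIn; punchOut; _↑ˡ_; _↑ʳ_)
  import Data.Fin.Properties as FinP
  open import Data.Product using (Σ; _×_; _,_; proj₁; proj₂)
  open import Data.Sum using (inj₁; inj₂)
  import Data.Sum.Properties as SumP
  open import Data.Bool as Bool using (Bool; true; false; if_then_else_; _∧_; not)
  import Data.Bool.Properties as BoolP
  open import Data.List as List using (List; []; _∷_; _++_; length; upTo)
  import Data.List.Properties as ListP
  import Data.List.Relation.Unary.All as All
  import Data.List.Relation.Unary.AllPairs as AllPairs
  import Data.List.Relation.Unary.Any as Any
  import Data.List.Relation.Unary.Any.Properties as AnyP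
  import Data.List.Membership.Propositional.Properties as MemP
  open import Data.Maybe as Maybe using (Maybe; just; nothing)
  open import Data.Vec as Vec using (Vec; lookup; tabulate)
  import Data.Vec.Properties as VecP
  open import Function.Bundles using (Equivalence)
  open import Relation.Binary.PropositionalEquality
  open import Relation.Nullary using (Dec; yes; no; ¬_; ⌊_⌋)
  open import Data.Empty using (⊥; ⊥-elim)
  open import Function.Base using (_∘_)
  open import Algebra.Properties.CommutativeSemigroup ℕP.*-commutativeSemigroup
    using () renaming (x∙yz≈y∙xz to *-left-swap)

  open import Defs

  ⌊⌋-sound : ∀ {P : Set} (d : Dec P) → ⌊ d ⌋ ≡ true → P
  ⌊⌋-sound (yes p) _ = p
  ⌊⌋-sound (no _) ()

  ⌊⌋-complete : ∀ {P : Set} (d : Dec P) → P → ⌊ d ⌋ ≡ true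
  ⌊⌋-complete (yes _) _ = refl
  ⌊⌋-complete (no ¬p) p = ⊥-elim (¬p p)

  ⌊⌋-false : ∀ {P : Set} (d : Dec P) → ¬ P → ⌊ d ⌋ ≡ false
  ⌊⌋-false (yes p) ¬p = ⊥-elim (¬p p)
  ⌊⌋-false (no _) _ = refl

  Bool-ext : ∀ (b c : Bool) → (b ≡ true → c ≡ true) → (c ≡ true → b ≡ true) → b ≡ c
  Bool-ext true true _ _ = refl
  Bool-ext true false f _ = sym (f refl)
  Bool-ext false true _ g = g refl
  Bool-ext false false _ _ = refl

  ∧-true : ∀ {b c : Bool} → b ∧ c ≡ true → b ≡ true × c ≡ true
  ∧-true {b} {c} h = BoolP.∧-conicalˡ b c h , BoolP.∧-conicalʳ b c h

  ≟-as-if : ∀ b c → ⌊ b Bool.≟ c ⌋ ≡ (if c then b else not b)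
  ≟-as-if false false = refl
  ≟-as-if false true = refl
  ≟-as-if true false = refl
  ≟-as-if true true = refl

  bit : Bool → ℕ
  bit b = if b then 1 else 0

  record Enumeration {A : Set} (P : A → Set) (k : ℕ) : Set where
    field
      enum       : Fin k → A
      enum-sat   : ∀ i → P (enum i)
      enum-inj   : ∀ i j → enum i ≡ enum j → i ≡ j
      index      : ∀ x → P x → Fin k
      enum-index : ∀ x (p : P x) → enum (index x p) ≡ x

  -- The size of an enumerated set is determined (Cantor–Schröder–Bernstein on Fin).
  enumeration-unique : ∀ {A : Set} {P : A → Set} {a b} → Enumeration P a → Enumeration P b → a ≡ b
  enumeration-unique {a = a} {b} E F = FinP.cantor-schröder-bernstein {f = E→F} {g = F→E} E→F-inj F→E-inj
    where
      module E = Enumeration E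
      module F = Enumeration F
      E→F : Fin a → Fin b
      E→F i = F.index (E.enum i) (E.enum-sat i)
      F→E : Fin b → Fin a
      F→E i = E.index (F.enum i) (F.enum-sat i)
      E→F-inj : ∀ {i j} → E→F i ≡ E→F j → i ≡ j
      E→F-inj {i} {j} e = E.enum-inj i j
        (trans (sym (F.enum-index _ (E.enum-sat i))) (trans (cong F.enum e) (F.enum-index _ (E.enum-sat j))))
      F→E-inj : ∀ {i j} → F→E i ≡ F→E j → i ≡ j
      F→E-inj {i} {j} e = F.enum-inj i j
        (trans (sym (E.enum-index _ (F.enum-sat i))) (trans (cong E.enum e) (E.enum-index _ (F.enum-sat j))))

  enumeration-resize : ∀ {A : Set} {P : A → Set} {a b} → a ≡ b → Enumeration P a → Enumeration P b
  enumeration-resize refl E = E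

  enumeration-transport : ∀ {A B : Set} {P : A → Set} {Q : B → Set} {k}
    (f : (x : A) → P x → B) (g : (y : B) → Q y → A)
    (f-sat : ∀ x p → Q (f x p)) (g-sat : ∀ y q → P (g y q))
    (g∘f : ∀ x p y q → f x p ≡ y → g y q ≡ x)
    (f∘g : ∀ y q x p → g y q ≡ x → f x p ≡ y)
    → Enumeration P k → Enumeration Q k
  enumeration-transport f g f-sat g-sat g∘f f∘g E = record
    { enum = λ i → f (E.enum i) (E.enum-sat i)
    ; enum-sat = λ i → f-sat _ _
    ; enum-inj = λ i j e → E.enum-inj i j
        (trans (sym (g∘f _ (E.enum-sat i) _ (f-sat _ (E.enum-sat j)) e))
               (g∘f _ (E.enum-sat j) _ (f-sat _ (E.enum-sat j)) refl))
    ; index = λ y q → E.index (g y q) (g-sat y q)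
    ; enum-index = λ y q → f∘g y q _ _ (sym (E.enum-index _ _))
    }
    where module E = Enumeration E

  enumeration-Σ : ∀ {A B : Set} {P : A → Set} {Q : A → B → Set} {a b}
    → Enumeration P a → (∀ x → P x → Enumeration (Q x) b)
    → Enumeration (λ (z : A × B) → P (proj₁ z) × Q (proj₁ z) (proj₂ z)) (a * b)
  enumeration-Σ {A} {B} {P} {Q} {a} {b} E fibre = record
    { enum = λ k → pair (Fin.remQuot {a} b k)
    ; enum-sat = λ k → pair-sat (Fin.remQuot {a} b k)
    ; enum-inj = λ k k' e → trans (sym (FinP.combine-remQuot {a} b k))
         (trans (cong (λ z → Fin.combine (proj₁ z) (proj₂ z)) (pair-inj (Fin.remQuot {a} b k) (Fin.remQuot {a} b k') e))
                (FinP.combine-remQuot {a} b k'))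
    ; index = λ z pq → Fin.combine (base-index z pq) (fibre-index z pq)
    ; enum-index = λ z pq → trans (cong pair (FinP.remQuot-combine {a} {b} _ _)) (pair-index z pq)
    }
    where
      module E = Enumeration E
      F : (i : Fin a) → Enumeration (Q (E.enum i)) b
      F i = fibre (E.enum i) (E.enum-sat i)
      pair : Fin a × Fin b → A × B
      pair (i , j) = E.enum i , Enumeration.enum (F i) j
      pair-sat : ∀ ij → P (proj₁ (pair ij)) × Q (proj₁ (pair ij)) (proj₂ (pair ij))
      pair-sat (i , j) = E.enum-sat i , Enumeration.enum-sat (F i) j
      pair-inj : ∀ ij ij' → pair ij ≡ pair ij' → ij ≡ ij'
      pair-inj (i , j) (i' , j') e with E.enum-inj i i' (cong proj₁ e)
      ... | refl = cong (i ,_) (Enumeration.enum-inj (F i) j j' (cong proj₂ e))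
      base-index : ∀ (z : A × B) → P (proj₁ z) × Q (proj₁ z) (proj₂ z) → Fin a
      base-index (x , _) (p , _) = E.index x p
      fibre-sat : ∀ z pq → Q (E.enum (base-index z pq)) (proj₂ z)
      fibre-sat (x , y) (p , q) = subst (λ x' → Q x' y) (sym (E.enum-index x p)) q
      fibre-index : ∀ z pq → Fin b
      fibre-index z pq = Enumeration.index (F (base-index z pq)) (proj₂ z) (fibre-sat z pq)
      pair-index : ∀ z pq → pair (base-index z pq , fibre-index z pq) ≡ z
      pair-index (x , y) (p , q) =
        cong₂ _,_ (E.enum-index x p) (Enumeration.enum-index (F _) y (fibre-sat (x , y) (p , q)))

  enumeration-singleton : ∀ {A : Set} {P : A → Set} (a : A) → P a → (∀ x → P x → x ≡ a) → Enumeration P 1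
  enumeration-singleton a pa unique = record
    { enum = λ _ → a ; enum-sat = λ _ → pa ; enum-inj = λ { zero zero _ → refl }
    ; index = λ _ _ → zero ; enum-index = λ x p → sym (unique x p) }

  hasCard⇒enumeration : ∀ {A : Set} {P : A → Set} {k} → HasCard P k → Enumeration P k
  hasCard⇒enumeration {P = P} (xs , unique , mem , refl) = record
    { enum = List.lookup xs
    ; enum-sat = λ i → Equivalence.to (mem _) (MemP.∈-lookup i)
    ; enum-inj = unique-lookup xs unique
    ; index = λ x p → Any.index (Equivalence.from (mem x) p)
    ; enum-index = λ x p → sym (AnyP.lookup-index (Equivalence.from (mem x) p)) }
    where
      unique-lookup : ∀ {X : Set} (xs : List X) → AllPairs.AllPairs _≢_ xs
        → ∀ i j → List.lookup xs i ≡ List.lookup xs j → i ≡ j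
      unique-lookup (x ∷ xs) (h AllPairs.∷ u) zero zero e = refl
      unique-lookup (x ∷ xs) (h AllPairs.∷ u) zero (suc j) e = ⊥-elim (All.lookup h (MemP.∈-lookup j) e)
      unique-lookup (x ∷ xs) (h AllPairs.∷ u) (suc i) zero e = ⊥-elim (All.lookup h (MemP.∈-lookup i) (sym e))
      unique-lookup (x ∷ xs) (h AllPairs.∷ u) (suc i) (suc j) e = cong suc (unique-lookup xs u i j e)

  countF-enumeration : ∀ {N} (p : Fin N → Bool) → Enumeration (λ v → p v ≡ true) (countF p)
  countF-enumeration {zero} p =
    record { enum = λ () ; enum-sat = λ () ; enum-inj = λ () ; index = λ () ; enum-index = λ () }
  countF-enumeration {suc N} p with p zero in p0 | countF-enumeration (λ v → p (suc v))
  ... | true | R = record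
    { enum = enum ; enum-sat = enum-sat ; enum-inj = enum-inj ; index = index ; enum-index = enum-index }
    where
      module R = Enumeration R
      enum : Fin (suc (countF (λ v → p (suc v)))) → Fin (suc N)
      enum zero = zero
      enum (suc i) = suc (R.enum i)
      enum-sat : ∀ i → p (enum i) ≡ true
      enum-sat zero = p0
      enum-sat (suc i) = R.enum-sat i
      enum-inj : ∀ i j → enum i ≡ enum j → i ≡ j
      enum-inj zero zero _ = refl
      enum-inj (suc i) (suc j) e = cong suc (R.enum-inj i j (FinP.suc-injective e))
      index : ∀ v → p v ≡ true → Fin (suc (countF (λ v → p (suc v))))
      index zero _ = zero
      index (suc v) q = suc (R.index v q)
      enum-index : ∀ v q → enum (index v q) ≡ v
      enum-index zero _ = refl
      enum-index (suc v) q = cong suc (R.enum-index v q)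
  ... | false | R = record
    { enum = λ i → suc (R.enum i) ; enum-sat = R.enum-sat
    ; enum-inj = λ i j e → R.enum-inj i j (FinP.suc-injective e) ; index = index ; enum-index = enum-index }
    where
      module R = Enumeration R
      index : ∀ v → p v ≡ true → Fin (countF (λ v → p (suc v)))
      index zero q with () ← trans (sym q) p0
      index (suc v) q = R.index v q
      enum-index : ∀ v q → suc (R.enum (index v q)) ≡ v
      enum-index zero q with () ← trans (sym q) p0
      enum-index (suc v) q = cong suc (R.enum-index v q)

  countF-from-enumeration : ∀ {N k} (p : Fin N → Bool) → Enumeration (λ v → p v ≡ true) k → countF p ≡ k
  countF-from-enumeration p E = enumeration-unique (countF-enumeration p) E

  countF-cong : ∀ {N} (p q : Fin N → Bool) → (∀ v → p v ≡ q v) → countF p ≡ countF q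
  countF-cong {zero} p q e = refl
  countF-cong {suc N} p q e = cong₂ _+_ (cong bit (e zero)) (countF-cong _ _ (λ v → e (suc v)))

  countF-reindex : ∀ {n N} (σ : Fin n → Fin N) (σ⁻¹ : Fin N → Fin n)
    → (∀ v → σ⁻¹ (σ v) ≡ v) → (∀ x → σ (σ⁻¹ x) ≡ x)
    → (p : Fin N → Bool) → countF p ≡ countF (λ v → p (σ v))
  countF-reindex σ σ⁻¹ left right p = countF-from-enumeration p (enumeration-transport
    (λ v _ → σ v) (λ x _ → σ⁻¹ x) (λ v q → q) (λ x q → subst (λ y → p y ≡ true) (sym (right x)) q)
    (λ x _ y _ e → trans (cong σ⁻¹ (sym e)) (left x)) (λ y _ x _ e → trans (cong σ (sym e)) (right y))
    (countF-enumeration (λ v → p (σ v))))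

  countF-punchIn : ∀ {N} (p : Fin (suc N) → Bool) (y : Fin (suc N))
    → countF p ≡ bit (p y) + countF (λ v → p (punchIn y v))
  countF-punchIn p zero = refl
  countF-punchIn {suc N} p (suc y) = begin
    bit (p zero) + countF (λ v → p (suc v))
      ≡⟨ cong (bit (p zero) +_) (countF-punchIn (λ v → p (suc v)) y) ⟩
    bit (p zero) + (bit (p (suc y)) + rest)
      ≡⟨ ℕP.+-comm (bit (p zero)) _ ⟩
    (bit (p (suc y)) + rest) + bit (p zero)
      ≡⟨ ℕP.+-assoc (bit (p (suc y))) rest _ ⟩
    bit (p (suc y)) + (rest + bit (p zero))
      ≡⟨ cong (bit (p (suc y)) +_) (ℕP.+-comm rest _) ⟩
    bit (p (suc y)) + (bit (p zero) + rest) ∎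
    where
      open ≡-Reasoning
      rest : ℕ
      rest = countF (λ v → p (suc (punchIn y v)))

  countF-positive : ∀ {N} (p : Fin N → Bool) v → p v ≡ true → Σ ℕ λ t → countF p ≡ suc t
  countF-positive p v pv with countF p | countF-enumeration p
  ... | zero | E with () ← Enumeration.index E v pv
  ... | suc t | _ = t , refl

  countF-zero : ∀ {N} (p : Fin N → Bool) v → countF p ≡ 0 → p v ≡ true → ⊥
  countF-zero p v zero-count pv with countF-positive p v pv
  ... | t , pos with () ← trans (sym zero-count) pos

  countF-two : ∀ {N} (p : Fin N → Bool) x y → p x ≡ true → p y ≡ true → x ≢ y → 2 ≤ countF p
  countF-two {suc N} p x y px py x≢y
    with countF-positive (λ v → p (punchIn x v)) (punchOut x≢y) (trans (cong p (FinP.punchIn-punchOut x≢y)) py)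
  ... | t , rest = ℕP.≤-trans (s≤s (s≤s z≤n))
    (ℕP.≤-reflexive (sym (trans (countF-punchIn p x) (cong₂ _+_ (cong bit px) rest))))

  countF-single : ∀ {N} (u : Fin N) → countF (λ v → ⌊ v Fin.≟ u ⌋) ≡ 1
  countF-single u = countF-from-enumeration _
    (enumeration-singleton u (⌊⌋-complete (u Fin.≟ u) refl) (λ x p → ⌊⌋-sound (x Fin.≟ u) p))

  countF-all : ∀ N → countF {N} (λ _ → true) ≡ N
  countF-all zero = refl
  countF-all (suc N) = cong suc (countF-all N)

  countF-split : ∀ {N} (p q : Fin N → Bool)
    → countF p ≡ countF (λ v → p v ∧ q v) + countF (λ v → p v ∧ not (q v))
  countF-split {zero} p q = refl
  countF-split {suc N} p q =
    trans (cong (bit (p zero) +_) (countF-split (λ v → p (suc v)) (λ v → q (suc v)))) (head (p zero) (q zero))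
    where
      X Y : ℕ
      X = countF (λ v → p (suc v) ∧ q (suc v))
      Y = countF (λ v → p (suc v) ∧ not (q (suc v)))
      head : ∀ b c → bit b + (X + Y) ≡ (bit (b ∧ c) + X) + (bit (b ∧ not c) + Y)
      head false c = refl
      head true true = refl
      head true false = trans (cong suc (ℕP.+-comm X Y)) (ℕP.+-comm (suc Y) X)

  IsInjection : ∀ {n N} → Vec (Fin N) n → Set
  IsInjection σ = ∀ u v → lookup σ u ≡ lookup σ v → u ≡ v

  PreservesColour : ∀ {n N K} (c : Fin n → Fin K) (d : Fin N → Fin K) → Vec (Fin N) n → Set
  PreservesColour c d σ = ∀ v → d (lookup σ v) ≡ c v

  ColourMatching : ∀ {n N K} (c : Fin n → Fin K) (d : Fin N → Fin K) → Vec (Fin N) n → Set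
  ColourMatching c d σ = IsInjection σ × PreservesColour c d σ

  classSize : ∀ {N K} → (Fin N → Fin K) → Fin K → ℕ
  classSize c i = countF (λ v → ⌊ c v Fin.≟ i ⌋)

  factorialProduct : ∀ {K} → Vec ℕ K → ℕ
  factorialProduct ms = prodV (Vec.map _! ms)

  factorialProduct-decrement : ∀ {K} (ms : Vec ℕ K) j t → lookup ms j ≡ suc t
    → factorialProduct ms ≡ suc t * factorialProduct (ms Vec.[ j ]≔ t)
  factorialProduct-decrement (x Vec.∷ xs) zero t refl = ℕP.*-assoc (suc t) (t !) _
  factorialProduct-decrement (x Vec.∷ xs) (suc j) t e = begin
    x ! * factorialProduct xs                                ≡⟨ cong (x ! *_) (factorialProduct-decrement xs j t e) ⟩
    x ! * (suc t * factorialProduct (xs Vec.[ j ]≔ t))        ≡⟨ *-left-swap (x !) (suc t) _ ⟩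
    suc t * (x ! * factorialProduct (xs Vec.[ j ]≔ t))        ∎
    where open ≡-Reasoning

  factorialProduct-zeros : ∀ {K} (ms : Vec ℕ K) → (∀ i → lookup ms i ≡ 0) → factorialProduct ms ≡ 1
  factorialProduct-zeros Vec.[] _ = refl
  factorialProduct-zeros (x Vec.∷ xs) h rewrite h zero = trans (ℕP.+-identityʳ _) (factorialProduct-zeros xs (λ i → h (suc i)))

  classSize-remove : ∀ {N K} (c : Fin (suc N) → Fin K) (ms : Vec ℕ K) (y : Fin (suc N)) t
    → (∀ i → classSize c i ≡ lookup ms i) → lookup ms (c y) ≡ suc t
    → ∀ i → classSize (λ v → c (punchIn y v)) i ≡ lookup (ms Vec.[ c y ]≔ t) i
  classSize-remove c ms y t sizes my i with c y Fin.≟ i | countF-punchIn (λ v → ⌊ c v Fin.≟ i ⌋) y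
  ... | yes refl | split = trans
    (ℕP.suc-injective (trans (sym split) (trans (sizes (c y)) my)))
    (sym (VecP.lookup∘update (c y) ms t))
  ... | no cy≢i | split = trans (trans (sym split) (sizes i)) (sym (VecP.lookup∘update′ (cy≢i ∘ sym) ms t))

  -- One step of the count: a matching of Fin (suc n) into Fin (suc N) is the image y
  -- of 0 (a point of colour c 0) together with a matching of the other points
  -- into Fin (suc N) minus y, i.e. into Fin N via punchIn y.
  module ConsSplit {n N K : ℕ} (c : Fin (suc n) → Fin K) (d : Fin (suc N) → Fin K) where

    Rest : Fin (suc N) → Vec (Fin N) n → Set
    Rest y = ColourMatching (λ v → c (suc v)) (λ v → d (punchIn y v))

    Pairs : Fin (suc N) × Vec (Fin N) n → Set
    Pairs (y , τ) = ⌊ d y Fin.≟ c zero ⌋ ≡ true × Rest y τ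

    cons : ∀ z → Pairs z → Vec (Fin (suc N)) (suc n)
    cons (y , τ) _ = y Vec.∷ Vec.map (punchIn y) τ

    lookup-punched : ∀ y (τ : Vec (Fin N) n) v → lookup (Vec.map (punchIn y) τ) v ≡ punchIn y (lookup τ v)
    lookup-punched y τ v = VecP.lookup-map v (punchIn y) τ

    cons-sat : ∀ z p → ColourMatching c d (cons z p)
    cons-sat (y , τ) (dy , τ-inj , τ-col) = inj , col
      where
        inj : IsInjection (y Vec.∷ Vec.map (punchIn y) τ)
        inj zero zero _ = refl
        inj zero (suc v) e = ⊥-elim (FinP.punchInᵢ≢i y (lookup τ v) (sym (trans e (lookup-punched y τ v))))
        inj (suc u) zero e = ⊥-elim (FinP.punchInᵢ≢i y (lookup τ u) (trans (sym (lookup-punched y τ u)) e))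
        inj (suc u) (suc v) e = cong suc (τ-inj u v (FinP.punchIn-injective y _ _
          (trans (sym (lookup-punched y τ u)) (trans e (lookup-punched y τ v)))))
        col : PreservesColour c d (y Vec.∷ Vec.map (punchIn y) τ)
        col zero = ⌊⌋-sound (d y Fin.≟ c zero) dy
        col (suc v) = trans (cong d (lookup-punched y τ v)) (τ-col v)

    avoids : ∀ σ → ColourMatching c d σ → ∀ v → lookup σ zero ≢ lookup σ (suc v)
    avoids σ (inj , _) v e with () ← inj zero (suc v) e

    split : ∀ σ → ColourMatching c d σ → Fin (suc N) × Vec (Fin N) n
    split σ m = lookup σ zero , tabulate (λ v → punchOut (avoids σ m v))

    split-sat : ∀ σ m → Pairs (split σ m)
    split-sat σ m@(inj , col) = ⌊⌋-complete (d (lookup σ zero) Fin.≟ c zero) (col zero) , inj′ , col′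
      where
        rest : Vec (Fin N) n
        rest = tabulate (λ v → punchOut (avoids σ m v))
        lookup-rest : ∀ v → lookup rest v ≡ punchOut (avoids σ m v)
        lookup-rest v = VecP.lookup∘tabulate _ v
        inj′ : IsInjection rest
        inj′ u v e = FinP.suc-injective (inj (suc u) (suc v)
          (FinP.punchOut-injective (avoids σ m u) (avoids σ m v) (trans (sym (lookup-rest u)) (trans e (lookup-rest v)))))
        col′ : PreservesColour (λ v → c (suc v)) (λ v → d (punchIn (lookup σ zero) v)) rest
        col′ v = trans (cong (λ w → d (punchIn (lookup σ zero) w)) (lookup-rest v))
                       (trans (cong d (FinP.punchIn-punchOut (avoids σ m v))) (col (suc v)))

    split∘cons : ∀ z p σ m → cons z p ≡ σ → split σ m ≡ z
    split∘cons (y , τ) p .(y Vec.∷ Vec.map (punchIn y) τ) m refl = cong (y ,_)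
      (trans (VecP.tabulate-cong (λ v → trans (FinP.punchOut-cong′ y (lookup-punched y τ v)) (FinP.punchOut-punchIn y)))
             (VecP.tabulate∘lookup τ))

    cons∘split : ∀ σ m z p → split σ m ≡ z → cons z p ≡ σ
    cons∘split (s Vec.∷ σs) m .(split (s Vec.∷ σs) m) p refl = cong (s Vec.∷_)
      (trans (sym (VecP.tabulate-∘ (punchIn s) (λ v → punchOut (avoids (s Vec.∷ σs) m v))))
      (trans (VecP.tabulate-cong (λ v → FinP.punchIn-punchOut (avoids (s Vec.∷ σs) m v))) (VecP.tabulate∘lookup σs)))

  matchings-cons : ∀ {n N K} (c : Fin (suc n) → Fin K) (d : Fin (suc N) → Fin K) {a b}
    → Enumeration (λ y → ⌊ d y Fin.≟ c zero ⌋ ≡ true) a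
    → (∀ y → d y ≡ c zero → Enumeration (ColourMatching (λ v → c (suc v)) (λ v → d (punchIn y v))) b)
    → Enumeration (ColourMatching c d) (a * b)
  matchings-cons c d Y fibres = enumeration-transport cons split cons-sat split-sat split∘cons cons∘split
    (enumeration-Σ Y (λ y dy → fibres y (⌊⌋-sound (d y Fin.≟ c zero) dy)))
    where open ConsSplit c d

  colour-of-0 : ∀ {n K} (c : Fin (suc n) → Fin K) (ms : Vec ℕ K)
    → (∀ i → classSize c i ≡ lookup ms i) → Σ ℕ λ t → lookup ms (c zero) ≡ suc t
  colour-of-0 c ms c-sizes with countF-positive (λ v → ⌊ c v Fin.≟ c zero ⌋) zero (⌊⌋-complete (c zero Fin.≟ c zero) refl)
  ... | t , c₀-class = t , trans (sym (c-sizes (c zero))) c₀-class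

  -- The counting lemma, by induction on n: the image of 0 is any of the m_{c 0}
  -- points of its colour, and the rest is a matching with that class decremented.
  count-matchings : ∀ {K} n {N} (c : Fin n → Fin K) (d : Fin N → Fin K) (ms : Vec ℕ K)
    → (∀ i → classSize c i ≡ lookup ms i) → (∀ i → classSize d i ≡ lookup ms i)
    → Enumeration (ColourMatching c d) (factorialProduct ms)
  count-matchings zero c d ms c-sizes d-sizes =
    enumeration-resize (sym (factorialProduct-zeros ms (λ i → sym (c-sizes i))))
      (enumeration-singleton Vec.[] ((λ ()) , (λ ())) (λ { Vec.[] _ → refl }))
  count-matchings (suc n) {zero} c d ms c-sizes d-sizes with colour-of-0 c ms c-sizes
  ... | t , m₀ with () ← trans (d-sizes (c zero)) m₀
  count-matchings (suc n) {suc N} c d ms c-sizes d-sizes with colour-of-0 c ms c-sizes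
  ... | t , m₀ = enumeration-resize (sym (factorialProduct-decrement ms (c zero) t m₀))
    (matchings-cons c d
      (enumeration-resize (trans (d-sizes (c zero)) m₀) (countF-enumeration (λ y → ⌊ d y Fin.≟ c zero ⌋)))
      (λ y dy → count-matchings n (λ v → c (suc v)) (λ v → d (punchIn y v)) (ms Vec.[ c zero ]≔ t)
        (classSize-remove c ms zero t c-sizes m₀)
        (subst (λ j → ∀ i → classSize (λ v → d (punchIn y v)) i ≡ lookup (ms Vec.[ j ]≔ t) i) dy
          (classSize-remove d ms y t d-sizes (trans (cong (lookup ms) dy) m₀)))))

  countL : ∀ {X : Set} → (X → Bool) → List X → ℕ
  countL p [] = 0
  countL p (x ∷ xs) = bit (p x) + countL p xs

  countL-++ : ∀ {X : Set} (p : X → Bool) xs ys → countL p (xs ++ ys) ≡ countL p xs + countL p ys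
  countL-++ p [] ys = refl
  countL-++ p (x ∷ xs) ys = trans (cong (bit (p x) +_) (countL-++ p xs ys)) (sym (ℕP.+-assoc (bit (p x)) _ _))

  countL-map : ∀ {X Y : Set} (p : Y → Bool) (f : X → Y) xs → countL p (List.map f xs) ≡ countL (p ∘ f) xs
  countL-map p f [] = refl
  countL-map p f (x ∷ xs) = cong (bit (p (f x)) +_) (countL-map p f xs)

  countL-cong : ∀ {X : Set} (p q : X → Bool) xs → (∀ x → p x ≡ q x) → countL p xs ≡ countL q xs
  countL-cong p q [] h = refl
  countL-cong p q (x ∷ xs) h = cong₂ _+_ (cong bit (h x)) (countL-cong p q xs h)

  countL-false : ∀ {X : Set} (p : X → Bool) xs → (∀ x → p x ≡ false) → countL p xs ≡ 0
  countL-false p [] h = refl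
  countL-false p (x ∷ xs) h rewrite h x = countL-false p xs h

  countL-true : ∀ {X : Set} (p : X → Bool) xs → (∀ x → p x ≡ true) → countL p xs ≡ length xs
  countL-true p [] h = refl
  countL-true p (x ∷ xs) h rewrite h x = cong suc (countL-true p xs h)

  countF-lookup : ∀ {X : Set} (xs : List X) (p : X → Bool) → countF (p ∘ List.lookup xs) ≡ countL p xs
  countF-lookup [] p = refl
  countF-lookup (x ∷ xs) p = cong (bit (p x) +_) (countF-lookup xs p)

  -- Counts along upTo m = [0 … m-1] of predicates on the shifted values 1 … m.

  countL-upTo-suc : ∀ (h : ℕ → Bool) m → countL h (upTo (suc m)) ≡ bit (h 0) + countL (h ∘ suc) (upTo m)
  countL-upTo-suc h m = cong (bit (h 0) +_)
    (trans (cong (countL h) (sym (ListP.map-applyUpTo (λ j → j) suc m))) (countL-map h suc (upTo m)))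

  ≟-suc : ∀ a b → ⌊ suc a ℕ.≟ suc b ⌋ ≡ ⌊ a ℕ.≟ b ⌋
  ≟-suc a b with a ℕ.≟ b
  ... | yes e = ⌊⌋-complete (suc a ℕ.≟ suc b) (cong suc e)
  ... | no a≢b = ⌊⌋-false (suc a ℕ.≟ suc b) (a≢b ∘ ℕP.suc-injective)

  upTo-count-all : ∀ m → countL (λ _ → true) (upTo m) ≡ m
  upTo-count-all m = trans (countL-true _ (upTo m) (λ _ → refl)) (ListP.length-upTo m)

  upTo-count-≢1 : ∀ m → countL (λ j → not ⌊ suc j ℕ.≟ 1 ⌋) (upTo m) ≡ m ∸ 1
  upTo-count-≢1 zero = refl
  upTo-count-≢1 (suc m) = trans (countL-upTo-suc (λ j → not ⌊ suc j ℕ.≟ 1 ⌋) m)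
    (trans (countL-cong _ (λ _ → true) (upTo m) (λ j → cong not (≟-suc (suc j) 0))) (upTo-count-all m))

  upTo-count-≡1 : ∀ m → 1 ≤ m → countL (λ j → ⌊ suc j ℕ.≟ 1 ⌋) (upTo m) ≡ 1
  upTo-count-≡1 (suc m) _ = trans (countL-upTo-suc (λ j → ⌊ suc j ℕ.≟ 1 ⌋) m)
    (cong suc (countL-false _ (upTo m) (λ j → ≟-suc (suc j) 0)))

  upTo-count-≡ : ∀ m j₀ → countL (λ j → ⌊ suc j ℕ.≟ j₀ ⌋) (upTo m) ≤ 1
  upTo-count-≡ zero j₀ = z≤n
  upTo-count-≡ (suc m) zero = ℕP.≤-trans (ℕP.≤-reflexive (countL-false _ (upTo (suc m)) (λ j → refl))) z≤n
  upTo-count-≡ (suc m) (suc zero) = ℕP.≤-reflexive (upTo-count-≡1 (suc m) (s≤s z≤n))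
  upTo-count-≡ (suc m) (suc (suc j₀)) = ℕP.≤-trans
    (ℕP.≤-reflexive (trans (countL-upTo-suc (λ j → ⌊ suc j ℕ.≟ suc (suc j₀) ⌋) m)
                           (countL-cong _ _ (upTo m) (λ j → ≟-suc (suc j) (suc j₀)))))
    (upTo-count-≡ m (suc j₀))

  shift : ℕ × ℕ → ℕ × ℕ
  shift (i , j) = (suc i , j)

  labels : ∀ {k} → Vec ℕ k → List (ℕ × ℕ)
  labels Vec.[] = []
  labels (x Vec.∷ xs) = List.map (λ j → (0 , suc j)) (upTo x) ++ List.map shift (labels xs)

  labels-spec : ∀ {k} (ns : Vec ℕ k)
    → List.concatMap (λ i → List.map (λ j → (toℕ i , suc j)) (upTo (lookup ns i))) (List.allFin k) ≡ labels ns
  labels-spec Vec.[] = refl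
  labels-spec {suc k} (x Vec.∷ xs) = cong (List.map (λ j → (0 , suc j)) (upTo x) ++_) (begin
    List.concat (List.map block (List.tabulate suc))
      ≡⟨ cong List.concat (ListP.map-tabulate suc block) ⟩
    List.concat (List.tabulate (block ∘ suc))
      ≡⟨ cong List.concat (ListP.tabulate-cong (λ i →
           ListP.map-∘ {g = shift} {f = λ j → (toℕ i , suc j)} (upTo (lookup xs i)))) ⟩
    List.concat (List.tabulate (List.map shift ∘ block′))
      ≡⟨ cong List.concat (sym (ListP.map-tabulate block′ (List.map shift))) ⟩
    List.concat (List.map (List.map shift) (List.tabulate block′))
      ≡⟨ ListP.concat-map (List.tabulate block′) ⟩
    List.map shift (List.concat (List.tabulate block′))
      ≡⟨ cong (List.map shift ∘ List.concat) (sym (ListP.map-tabulate (λ i → i) block′)) ⟩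
    List.map shift (List.concatMap block′ (List.allFin k))
      ≡⟨ cong (List.map shift) (labels-spec xs) ⟩
    List.map shift (labels xs) ∎)
    where
      open ≡-Reasoning
      block : Fin (suc k) → List (ℕ × ℕ)
      block i = List.map (λ j → (toℕ i , suc j)) (upTo (lookup (x Vec.∷ xs) i))
      block′ : Fin k → List (ℕ × ℕ)
      block′ i = List.map (λ j → (toℕ i , suc j)) (upTo (lookup xs i))

  countL-labels-∷ : ∀ {k} (p : ℕ × ℕ → Bool) x (xs : Vec ℕ k)
    → countL p (labels (x Vec.∷ xs)) ≡ countL (λ j → p (0 , suc j)) (upTo x) + countL (p ∘ shift) (labels xs)
  countL-labels-∷ p x xs = trans (countL-++ p (List.map (λ j → (0 , suc j)) (upTo x)) _)
    (cong₂ _+_ (countL-map p _ (upTo x)) (countL-map p shift (labels xs)))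

  countL-level : ∀ {k} (ns : Vec ℕ k) (h : ℕ → Bool) (i : Fin k)
    → countL (λ e → ⌊ proj₁ e ℕ.≟ toℕ i ⌋ ∧ h (proj₂ e)) (labels ns) ≡ countL (h ∘ suc) (upTo (lookup ns i))
  countL-level (x Vec.∷ xs) h zero = trans (countL-labels-∷ _ x xs)
    (trans (cong (countL (h ∘ suc) (upTo x) +_) (countL-false _ (labels xs) (λ e → refl))) (ℕP.+-identityʳ _))
  countL-level (x Vec.∷ xs) h (suc i) = trans (countL-labels-∷ _ x xs) (trans (cong₂ _+_
    (countL-false _ (upTo x) (λ j → refl))
    (countL-cong _ _ (labels xs) (λ e → cong (_∧ h (proj₂ e)) (≟-suc (proj₁ e) (toℕ i))))) (countL-level xs h i))

  countL-level-beyond : ∀ {k} (ns : Vec ℕ k) (h : ℕ → Bool) ℓ → k ≤ ℓ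
    → countL (λ e → ⌊ proj₁ e ℕ.≟ ℓ ⌋ ∧ h (proj₂ e)) (labels ns) ≡ 0
  countL-level-beyond Vec.[] h ℓ _ = refl
  countL-level-beyond (x Vec.∷ xs) h (suc ℓ) (s≤s k≤ℓ) = trans (countL-labels-∷ _ x xs) (cong₂ _+_
    (countL-false _ (upTo x) (λ j → refl))
    (trans (countL-cong _ _ (labels xs) (λ e → cong (_∧ h (proj₂ e)) (≟-suc (proj₁ e) ℓ)))
           (countL-level-beyond xs h ℓ k≤ℓ)))

  length-labels : ∀ {k} (ns : Vec ℕ k) → length (labels ns) ≡ Vec.sum ns
  length-labels Vec.[] = refl
  length-labels (x Vec.∷ xs) = begin
    length (labels (x Vec.∷ xs))
      ≡⟨ sym (countL-true _ (labels (x Vec.∷ xs)) (λ _ → refl)) ⟩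
    countL (λ _ → true) (labels (x Vec.∷ xs))
      ≡⟨ countL-labels-∷ _ x xs ⟩
    countL (λ _ → true) (upTo x) + countL (λ _ → true) (labels xs)
      ≡⟨ cong₂ _+_ (upTo-count-all x) (countL-true _ (labels xs) (λ _ → refl)) ⟩
    x + length (labels xs)
      ≡⟨ cong (x +_) (length-labels xs) ⟩
    x + Vec.sum xs ∎
    where open ≡-Reasoning

  module VertexSet {r : ℕ} (ns : Vec ℕ (suc r)) where

    countF-label : ∀ (p : ℕ × ℕ → Bool) → countF (p ∘ label ns) ≡ countL p (labels ns)
    countF-label p = trans (countF-lookup (Vlist ns) p) (cong (countL p) (labels-spec ns))

    Vsize≡n : Vsize ns ≡ Vec.sum ns
    Vsize≡n = trans (cong length (labels-spec ns)) (length-labels ns)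

    countF-at-level : ∀ (i : Fin (suc r)) (h : ℕ → Bool)
      → countF (λ x → ⌊ level ns x ℕ.≟ toℕ i ⌋ ∧ h (proj₂ (label ns x))) ≡ countL (h ∘ suc) (upTo (lookup ns i))
    countF-at-level i h = trans (countF-label (λ e → ⌊ proj₁ e ℕ.≟ toℕ i ⌋ ∧ h (proj₂ e))) (countL-level ns h i)

    countF-beyond-levels : ∀ ℓ (h : ℕ → Bool) → r < ℓ
      → countF (λ x → ⌊ level ns x ℕ.≟ ℓ ⌋ ∧ h (proj₂ (label ns x))) ≡ 0
    countF-beyond-levels ℓ h r<ℓ =
      trans (countF-label (λ e → ⌊ proj₁ e ℕ.≟ ℓ ⌋ ∧ h (proj₂ e))) (countL-level-beyond ns h ℓ r<ℓ)

    level-profile : ∀ i → countF (λ x → ⌊ level ns x ℕ.≟ toℕ i ⌋) ≡ lookup ns i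
    level-profile i = begin
      countF (λ x → ⌊ level ns x ℕ.≟ toℕ i ⌋)
        ≡⟨ countF-cong _ (λ x → ⌊ level ns x ℕ.≟ toℕ i ⌋ ∧ true) (λ x → sym (BoolP.∧-identityʳ _)) ⟩
      countF (λ x → ⌊ level ns x ℕ.≟ toℕ i ⌋ ∧ true)
        ≡⟨ countF-at-level i (λ _ → true) ⟩
      countL (λ _ → true) (upTo (lookup ns i))
        ≡⟨ upTo-count-all (lookup ns i) ⟩
      lookup ns i ∎
      where open ≡-Reasoning

    level-bound : ∀ x → level ns x ≤ r
    level-bound x with level ns x ℕ.≤? r
    ... | yes le = le
    ... | no nle = ⊥-elim (countF-zero (λ y → ⌊ level ns y ℕ.≟ level ns x ⌋ ∧ true) x
            (countF-beyond-levels (level ns x) (λ _ → true) (ℕP.≰⇒> nle))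
            (cong (_∧ true) (⌊⌋-complete (level ns x ℕ.≟ level ns x) refl)))

    label-occurs-once : ∀ ℓ j → countF (λ x → ⌊ level ns x ℕ.≟ ℓ ⌋ ∧ ⌊ proj₂ (label ns x) ℕ.≟ j ⌋) ≤ 1
    label-occurs-once ℓ j with ℓ ℕ.<? suc r
    ... | yes ℓ≤r = subst (λ k → countF (λ x → ⌊ level ns x ℕ.≟ k ⌋ ∧ ⌊ proj₂ (label ns x) ℕ.≟ j ⌋) ≤ 1)
          (FinP.toℕ-fromℕ< ℓ≤r)
          (ℕP.≤-trans (ℕP.≤-reflexive (countF-at-level (Fin.fromℕ< ℓ≤r) (λ b → ⌊ b ℕ.≟ j ⌋)))
                      (upTo-count-≡ (lookup ns (Fin.fromℕ< ℓ≤r)) j))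
    ... | no ℓ≰r = ℕP.≤-trans (ℕP.≤-reflexive (countF-beyond-levels ℓ (λ b → ⌊ b ℕ.≟ j ⌋) (ℕP.≰⇒> (ℓ≰r ∘ s≤s)))) z≤n

    label-injective : ∀ x y → label ns x ≡ label ns y → x ≡ y
    label-injective x y e with x Fin.≟ y
    ... | yes x≡y = x≡y
    ... | no x≢y = ⊥-elim (ℕP.<-irrefl refl (ℕP.≤-trans (countF-two same-label x y (reflexive x refl) (reflexive y (sym e)) x≢y)
                                              (label-occurs-once (level ns x) (proj₂ (label ns x)))))
      where
        same-label : Fin (Vsize ns) → Bool
        same-label z = ⌊ level ns z ℕ.≟ level ns x ⌋ ∧ ⌊ proj₂ (label ns z) ℕ.≟ proj₂ (label ns x) ⌋
        reflexive : ∀ z → label ns z ≡ label ns x → same-label z ≡ true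
        reflexive z ez = cong₂ _∧_ (⌊⌋-complete (level ns z ℕ.≟ level ns x) (cong proj₁ ez))
                                   (⌊⌋-complete (proj₂ (label ns z) ℕ.≟ proj₂ (label ns x)) (cong proj₂ ez))

    count-not-first : ∀ i
      → countF (λ x → ⌊ level ns x ℕ.≟ toℕ i ⌋ ∧ not ⌊ proj₂ (label ns x) ℕ.≟ 1 ⌋) ≡ lookup ns i ∸ 1
    count-not-first i = trans (countF-at-level i (λ b → not ⌊ b ℕ.≟ 1 ⌋)) (upTo-count-≢1 (lookup ns i))

    count-first : ∀ i → 1 ≤ lookup ns i
      → countF (λ x → ⌊ level ns x ℕ.≟ toℕ i ⌋ ∧ ⌊ proj₂ (label ns x) ℕ.≟ 1 ⌋) ≡ 1
    count-first i pos = trans (countF-at-level i (λ b → ⌊ b ℕ.≟ 1 ⌋)) (upTo-count-≡1 (lookup ns i) pos)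

  module Relabelling {n₁ n₂ : ℕ} (σ : Fin n₁ → Fin n₂) (σ⁻¹ : Fin n₂ → Fin n₁)
    (left : ∀ v → σ⁻¹ (σ v) ≡ v) (right : ∀ x → σ (σ⁻¹ x) ≡ x)
    (ρ₁ : Fin n₁) (par₁ : Fin n₁ → Fin n₁) (a₁ : Fin n₁ → ℕ)
    (ρ₂ : Fin n₂) (par₂ : Fin n₂ → Fin n₂) (a₂ : Fin n₂ → ℕ)
    (σ-root : ρ₂ ≡ σ ρ₁) (σ-par : ∀ v → par₂ (σ v) ≡ σ (par₁ v)) (σ-abscissa : ∀ v → a₂ (σ v) ≡ a₁ v) where

    σ-injective : ∀ u v → σ u ≡ σ v → u ≡ v
    σ-injective u v e = trans (sym (left u)) (trans (cong σ⁻¹ e) (left v))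

    σ-≟ : ∀ u v → ⌊ σ u Fin.≟ σ v ⌋ ≡ ⌊ u Fin.≟ v ⌋
    σ-≟ u v with u Fin.≟ v
    ... | yes e = ⌊⌋-complete (σ u Fin.≟ σ v) (cong σ e)
    ... | no ne = ⌊⌋-false (σ u Fin.≟ σ v) (λ e → ne (σ-injective u v e))

    σ-≟root : ∀ u → ⌊ σ u Fin.≟ ρ₂ ⌋ ≡ ⌊ u Fin.≟ ρ₁ ⌋
    σ-≟root u = trans (cong (λ z → ⌊ σ u Fin.≟ z ⌋) σ-root) (σ-≟ u ρ₁)

    σ-iter : ∀ k v → iter par₂ k (σ v) ≡ σ (iter par₁ k v)
    σ-iter zero v = refl
    σ-iter (suc k) v = trans (cong par₂ (σ-iter k v)) (σ-par _)

    σ-step : ∀ v → ℤ.+ a₂ (σ v) ℤ.- ℤ.+ a₂ (par₂ (σ v)) ≡ ℤ.+ a₁ v ℤ.- ℤ.+ a₁ (par₁ v)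
    σ-step v = cong₂ (λ s t → ℤ.+ s ℤ.- ℤ.+ t) (σ-abscissa v) (trans (cong a₂ (σ-par v)) (σ-abscissa (par₁ v)))

    rooted : n₁ ≡ n₂ → Tree.IsRootedTree ρ₁ par₁ a₁ → Tree.IsRootedTree ρ₂ par₂ a₂
    rooted refl (root-fixed , reaches) =
      trans (cong par₂ σ-root) (trans (σ-par ρ₁) (trans (cong σ root-fixed) (sym σ-root))) ,
      λ x → trans (cong (iter par₂ n₂) (sym (right x)))
              (trans (σ-iter n₂ (σ⁻¹ x)) (trans (cong σ (reaches (σ⁻¹ x))) (sym σ-root)))

    steps : (S : ℤ → Set) → Tree.StepsIn ρ₁ par₁ a₁ S → Tree.StepsIn ρ₂ par₂ a₂ S
    steps S st x x≢ρ₂ = subst (λ y → S (ℤ.+ a₂ y ℤ.- ℤ.+ a₂ (par₂ y))) (right x)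
      (subst S (sym (σ-step (σ⁻¹ x))) (st (σ⁻¹ x) (λ e → x≢ρ₂ (trans (sym (right x)) (trans (cong σ e) (sym σ-root))))))

    σ-countF : ∀ (p : Fin n₂ → Bool) → countF p ≡ countF (p ∘ σ)
    σ-countF p = countF-reindex σ σ⁻¹ left right p

    σ-childrenAt : ∀ v k → Tree.childrenAt ρ₂ par₂ a₂ (σ v) k ≡ Tree.childrenAt ρ₁ par₁ a₁ v k
    σ-childrenAt v k = trans (σ-countF _) (countF-cong _ _ λ w →
       cong₂ _∧_ (cong not (σ-≟root w)) (cong₂ _∧_ (trans (cong (λ z → ⌊ z Fin.≟ σ v ⌋) (σ-par w)) (σ-≟ (par₁ w) v))
          (cong₂ (λ s t → ⌊ ℤ.+ s ℤ.≟ ℤ.+ t ℤ.+ k ⌋) (σ-abscissa w) (σ-abscissa v))))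

    σ-typeOf : ∀ m v → Tree.typeOf ρ₂ par₂ a₂ m (σ v) ≡ Tree.typeOf ρ₁ par₁ a₁ m v
    σ-typeOf m v = cong₂ _,_ (σ-abscissa v) (cong₂ _,_
       (cong₂ (λ b s → if b then nothing else just s) (σ-≟root v) (σ-step v))
       (VecP.tabulate-cong (λ j → σ-childrenAt v (m ℤ.+ ℤ.+ toℕ j))))

    typeDist : ∀ m (D : VType m → ℕ) → Tree.HasTypeDist ρ₁ par₁ a₁ m D → Tree.HasTypeDist ρ₂ par₂ a₂ m D
    typeDist m D dist t = trans (σ-countF _)
      (trans (countF-cong _ _ (λ v → cong (λ z → ⌊ _≟T_ {m} z t ⌋) (σ-typeOf m v))) (dist t))

    profile : ∀ ℓ → countF (λ x → ⌊ a₂ x ℕ.≟ ℓ ⌋) ≡ countF (λ v → ⌊ a₁ v ℕ.≟ ℓ ⌋)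
    profile ℓ = trans (σ-countF _) (countF-cong _ _ (λ v → cong (λ z → ⌊ z ℕ.≟ ℓ ⌋) (σ-abscissa v)))

    bound : ∀ R → (∀ v → a₁ v ≤ R) → ∀ x → a₂ x ≤ R
    bound R h x = subst (_≤ R) (trans (sym (σ-abscissa (σ⁻¹ x))) (cong a₂ (right x))) (h (σ⁻¹ x))

    σ-pathTo : ∀ k x → pathTo ρ₂ par₂ k (σ x) ≡ List.map σ (pathTo ρ₁ par₁ k x)
    σ-pathTo zero x = refl
    σ-pathTo (suc k) x = begin
      (if ⌊ σ x Fin.≟ ρ₂ ⌋ then σ x ∷ [] else σ x ∷ pathTo ρ₂ par₂ k (par₂ (σ x)))
        ≡⟨ cong₂ (λ b L → if b then σ x ∷ [] else σ x ∷ L) (σ-≟root x)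
                 (trans (cong (pathTo ρ₂ par₂ k) (σ-par x)) (σ-pathTo k (par₁ x))) ⟩
      (if ⌊ x Fin.≟ ρ₁ ⌋ then σ x ∷ [] else σ x ∷ List.map σ (pathTo ρ₁ par₁ k (par₁ x)))
        ≡⟨ sym (BoolP.if-float (List.map σ) ⌊ x Fin.≟ ρ₁ ⌋) ⟩
      List.map σ (pathTo ρ₁ par₁ (suc k) x) ∎
      where open ≡-Reasoning

    σ-predOfFirst : ∀ ℓ L → predOfFirst a₂ ℓ (List.map σ L) ≡ Maybe.map σ (predOfFirst a₁ ℓ L)
    σ-predOfFirst ℓ [] = refl
    σ-predOfFirst ℓ (x ∷ []) = refl
    σ-predOfFirst ℓ (x ∷ y ∷ L) = begin
      (if ⌊ a₂ (σ y) ℕ.≟ ℓ ⌋ then just (σ x) else predOfFirst a₂ ℓ (List.map σ (y ∷ L)))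
        ≡⟨ cong₂ (λ b M → if b then just (σ x) else M) (cong (λ z → ⌊ z ℕ.≟ ℓ ⌋) (σ-abscissa y)) (σ-predOfFirst ℓ (y ∷ L)) ⟩
      (if ⌊ a₁ y ℕ.≟ ℓ ⌋ then just (σ x) else Maybe.map σ (predOfFirst a₁ ℓ (y ∷ L)))
        ≡⟨ sym (BoolP.if-float (Maybe.map σ) ⌊ a₁ y ℕ.≟ ℓ ⌋) ⟩
      Maybe.map σ (predOfFirst a₁ ℓ (x ∷ y ∷ L)) ∎
      where open ≡-Reasoning

  -- If towards the root the abscissa drops by at most
  -- one per step (max S = 1) and the root has abscissa 0, then walking from a
  -- vertex x to the root, every level i < a(x) is reached, and the vertex just
  -- before the first vertex of level i lies at level i + 1.

  step≤1 : ∀ m n → ℤ.+ m ℤ.- ℤ.+ n ℤ.≤ ℤ.+ 1 → m ≤ suc n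
  step≤1 m n h with n ℕ.≤? m
  ... | no n≰m = ℕP.≤-trans (ℕP.<⇒≤ (ℕP.≰⇒> n≰m)) (ℕP.n≤1+n n)
  ... | yes n≤m = begin
    m            ≡⟨ sym (ℕP.m+[n∸m]≡n n≤m) ⟩
    n + (m ∸ n)  ≤⟨ ℕP.+-monoʳ-≤ n difference≤1 ⟩
    n + 1        ≡⟨ ℕP.+-comm n 1 ⟩
    suc n        ∎
    where
      open ℕP.≤-Reasoning
      difference≤1 : m ∸ n ≤ 1
      difference≤1 = ℤP.drop‿+≤+ (subst (ℤ._≤ ℤ.+ 1) (trans (ℤP.m-n≡m⊖n m n) (ℤP.⊖-≥ n≤m)) h)

  iter-suc : ∀ {A : Set} (f : A → A) k x → iter f (suc k) x ≡ iter f k (f x)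
  iter-suc f zero x = refl
  iter-suc f (suc k) x = cong f (iter-suc f k x)

  module Descent {n : ℕ} (ρ : Fin n) (par : Fin n → Fin n) (a : Fin n → ℕ)
    (root-level : a ρ ≡ 0) (step-up : ∀ v → v ≢ ρ → a v ≤ suc (a (par v))) where

    above-root : ∀ x i → suc i ≤ a x → x ≢ ρ
    above-root x i i<ax refl with () ← subst (suc i ≤_) root-level i<ax

    pathTo-head : ∀ k y → Σ (List (Fin n)) λ rest → pathTo ρ par k y ≡ y ∷ rest
    pathTo-head zero y = [] , refl
    pathTo-head (suc k) y with ⌊ y Fin.≟ ρ ⌋
    ... | true = [] , refl
    ... | false = pathTo ρ par k (par y) , refl

    pathTo-step : ∀ k x → x ≢ ρ → pathTo ρ par (suc k) x ≡ x ∷ pathTo ρ par k (par x)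
    pathTo-step k x x≢ρ = cong (λ b → if b then x ∷ [] else x ∷ pathTo ρ par k (par x)) (⌊⌋-false (x Fin.≟ ρ) x≢ρ)

    predOfFirst-path : ∀ k x i → x ≢ ρ → predOfFirst a i (pathTo ρ par (suc k) x)
      ≡ (if ⌊ a (par x) ℕ.≟ i ⌋ then just x else predOfFirst a i (pathTo ρ par k (par x)))
    predOfFirst-path k x i x≢ρ with pathTo-head k (par x)
    ... | rest , eh rewrite pathTo-step k x x≢ρ | eh = refl

    -- Walking from x (with fuel k enough to reach the root), the predecessor of the
    -- first vertex of level i < a x exists and lies at level i + 1: at each step the
    -- level drops by at most one, so it cannot jump past i.
    first-descent : ∀ k x → iter par k x ≡ ρ → ∀ i → suc i ≤ a x
      → Σ (Fin n) λ u → predOfFirst a i (pathTo ρ par k x) ≡ just u × a u ≡ suc i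
    first-descent zero x x≡ρ i i<ax = ⊥-elim (above-root x i i<ax x≡ρ)
    first-descent (suc k) x reaches i i<ax with above-root x i i<ax | a (par x) ℕ.≟ i
    ... | x≢ρ | yes parent-at-i = x , found-here , ℕP.≤-antisym x-below i<ax
      where
        found-here : predOfFirst a i (pathTo ρ par (suc k) x) ≡ just x
        found-here rewrite predOfFirst-path k x i x≢ρ | ⌊⌋-complete (a (par x) ℕ.≟ i) parent-at-i = refl
        x-below : a x ≤ suc i
        x-below = subst (λ z → a x ≤ suc z) parent-at-i (step-up x x≢ρ)
    ... | x≢ρ | no parent-not-at-i with first-descent k (par x) (trans (sym (iter-suc par k x)) reaches) i parent-above
      where
        parent-above : suc i ≤ a (par x)
        parent-above = ℕP.≤∧≢⇒< (ℕ.s≤s⁻¹ (ℕP.≤-trans i<ax (step-up x x≢ρ))) (parent-not-at-i ∘ sym)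
    ... | u , found , au = u , found-later , au
      where
        found-later : predOfFirst a i (pathTo ρ par (suc k) x) ≡ just u
        found-later rewrite predOfFirst-path k x i x≢ρ | ⌊⌋-false (a (par x) ℕ.≟ i) parent-not-at-i = found

  -- an injection Fin n → Fin N with N = n hits every point (pigeonhole)
  injection-surjective : ∀ {n N} (σ : Vec (Fin N) n) → N ≡ n → IsInjection σ → ∀ x → Σ (Fin n) λ v → lookup σ v ≡ x
  injection-surjective {n} {suc N′} σ N≡n inj x with FinP.any? (λ v → lookup σ v Fin.≟ x)
  ... | yes hit = hit
  ... | no miss = ⊥-elim (ℕP.<-irrefl refl (ℕP.≤-trans (ℕP.≤-reflexive N≡n) (FinP.injective⇒≤ {f = avoid-x} avoid-x-inj)))
    where
      -- σ misses x, so it factors through Fin N′ by punching x out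
      x≢σ : ∀ v → x ≢ lookup σ v
      x≢σ v e = miss (v , sym e)
      avoid-x : Fin n → Fin N′
      avoid-x v = punchOut (x≢σ v)
      avoid-x-inj : ∀ {u v} → avoid-x u ≡ avoid-x v → u ≡ v
      avoid-x-inj {u} {v} e = inj u v (FinP.punchOut-injective (x≢σ u) (x≢σ v) e)

  -- defined for every σ, an inverse when σ is injective
  inverse : ∀ {n N} → N ≡ n → Vec (Fin N) n → Fin N → Fin n
  inverse N≡n σ x with FinP.any? (λ v → lookup σ v Fin.≟ x)
  ... | yes (v , _) = v
  ... | no _ = Fin.cast N≡n x

  inverse-right : ∀ {n N} (N≡n : N ≡ n) (σ : Vec (Fin N) n) → IsInjection σ → ∀ x → lookup σ (inverse N≡n σ x) ≡ x
  inverse-right N≡n σ inj x with FinP.any? (λ v → lookup σ v Fin.≟ x)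
  ... | yes (v , e) = e
  ... | no miss = ⊥-elim (miss (injection-surjective σ N≡n inj x))

  inverse-left : ∀ {n N} (N≡n : N ≡ n) (σ : Vec (Fin N) n) → IsInjection σ → ∀ v → inverse N≡n σ (lookup σ v) ≡ v
  inverse-left N≡n σ inj v = inj _ _ (inverse-right N≡n σ inj (lookup σ v))

  -- A vertex at level ℓ ≤ r with a flag b (whether it is distinguished,
  -- resp. labelled ℓ^1) gets colour (ℓ , b) ∈ Fin (suc r + suc r): the left half
  -- for b = false, the right half for b = true.

  -- a level, read in Fin (suc r) (faithfully when it is ≤ r)
  clamp : ∀ r → ℕ → Fin (suc r)
  clamp r x with x ℕ.<? suc r
  ... | yes lt = Fin.fromℕ< lt
  ... | no _ = Fin.fromℕ r

  toℕ-clamp : ∀ r x → x ≤ r → toℕ (clamp r x) ≡ x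
  toℕ-clamp r x le with x ℕ.<? suc r
  ... | yes lt = FinP.toℕ-fromℕ< lt
  ... | no nlt = ⊥-elim (nlt (s≤s le))

  colour : ∀ r → ℕ → Bool → Fin (suc r + suc r)
  colour r ℓ b = if b then suc r ↑ʳ clamp r ℓ else clamp r ℓ ↑ˡ suc r

  clamp-toℕ : ∀ r (i : Fin (suc r)) → clamp r (toℕ i) ≡ i
  clamp-toℕ r i = FinP.toℕ-injective (toℕ-clamp r (toℕ i) (ℕ.s≤s⁻¹ (FinP.toℕ<n i)))

  clamp-injective : ∀ r ℓ ℓ′ → ℓ ≤ r → ℓ′ ≤ r → clamp r ℓ ≡ clamp r ℓ′ → ℓ ≡ ℓ′
  clamp-injective r ℓ ℓ′ ℓ≤r ℓ′≤r e = trans (sym (toℕ-clamp r ℓ ℓ≤r)) (trans (cong toℕ e) (toℕ-clamp r ℓ′ ℓ′≤r))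

  colour-injective : ∀ r ℓ ℓ′ b b′ → ℓ ≤ r → ℓ′ ≤ r → colour r ℓ b ≡ colour r ℓ′ b′ → ℓ ≡ ℓ′ × b ≡ b′
  colour-injective r ℓ ℓ′ b b′ ℓ≤r ℓ′≤r e with b | b′ | cong (Fin.splitAt (suc r)) e
  ... | false | false | e′ rewrite FinP.splitAt-↑ˡ (suc r) (clamp r ℓ) (suc r) | FinP.splitAt-↑ˡ (suc r) (clamp r ℓ′) (suc r)
    = clamp-injective r ℓ ℓ′ ℓ≤r ℓ′≤r (SumP.inj₁-injective e′) , refl
  ... | true | true | e′ rewrite FinP.splitAt-↑ʳ (suc r) (suc r) (clamp r ℓ) | FinP.splitAt-↑ʳ (suc r) (suc r) (clamp r ℓ′)
    = clamp-injective r ℓ ℓ′ ℓ≤r ℓ′≤r (SumP.inj₂-injective e′) , refl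
  ... | false | true | e′ rewrite FinP.splitAt-↑ˡ (suc r) (clamp r ℓ) (suc r) | FinP.splitAt-↑ʳ (suc r) (suc r) (clamp r ℓ′)
    with () ← e′
  ... | true | false | e′ rewrite FinP.splitAt-↑ʳ (suc r) (suc r) (clamp r ℓ) | FinP.splitAt-↑ˡ (suc r) (clamp r ℓ′) (suc r)
    with () ← e′

  colour-≟ : ∀ r ℓ ℓ′ b b′ → ℓ ≤ r → ℓ′ ≤ r
    → ⌊ colour r ℓ b Fin.≟ colour r ℓ′ b′ ⌋ ≡ ⌊ ℓ ℕ.≟ ℓ′ ⌋ ∧ ⌊ b Bool.≟ b′ ⌋
  colour-≟ r ℓ ℓ′ b b′ ℓ≤r ℓ′≤r = Bool-ext _ _
    (λ h → let e = colour-injective r ℓ ℓ′ b b′ ℓ≤r ℓ′≤r (⌊⌋-sound (colour r ℓ b Fin.≟ colour r ℓ′ b′) h)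
           in cong₂ _∧_ (⌊⌋-complete (ℓ ℕ.≟ ℓ′) (proj₁ e)) (⌊⌋-complete (b Bool.≟ b′) (proj₂ e)))
    (λ h → let e = ∧-true h in ⌊⌋-complete (colour r ℓ b Fin.≟ colour r ℓ′ b′)
       (cong₂ (colour r) (⌊⌋-sound (ℓ ℕ.≟ ℓ′) (proj₁ e)) (⌊⌋-sound (b Bool.≟ b′) (proj₂ e))))

  colourClassSizes : ∀ {r} → Vec ℕ (suc r) → Vec ℕ (suc r + suc r)
  colourClassSizes {r} ns = Vec.map (_∸ 1) ns Vec.++ Vec.replicate (suc r) 1

  factorialProduct-colourClassSizes : ∀ {r} (ns : Vec ℕ (suc r))
    → factorialProduct (colourClassSizes ns) ≡ prodV (Vec.map (λ x → (x ∸ 1) !) ns)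
  factorialProduct-colourClassSizes {r} ns = begin
    prodV (Vec.map _! (Vec.map (_∸ 1) ns Vec.++ Vec.replicate (suc r) 1))
      ≡⟨ cong prodV (VecP.map-++ _! (Vec.map (_∸ 1) ns) (Vec.replicate (suc r) 1)) ⟩
    prodV (Vec.map _! (Vec.map (_∸ 1) ns) Vec.++ Vec.map _! (Vec.replicate (suc r) 1))
      ≡⟨ prodV-++ (Vec.map _! (Vec.map (_∸ 1) ns)) _ ⟩
    prodV (Vec.map _! (Vec.map (_∸ 1) ns)) * prodV (Vec.map _! (Vec.replicate (suc r) 1))
      ≡⟨ cong₂ _*_ (cong prodV (sym (VecP.map-∘ _! (_∸ 1) ns))) (prodV-ones (suc r)) ⟩
    prodV (Vec.map (λ x → (x ∸ 1) !) ns) * 1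
      ≡⟨ ℕP.*-identityʳ _ ⟩
    prodV (Vec.map (λ x → (x ∸ 1) !) ns) ∎
    where
      open ≡-Reasoning
      prodV-++ : ∀ {a b} (xs : Vec ℕ a) (ys : Vec ℕ b) → prodV (xs Vec.++ ys) ≡ prodV xs * prodV ys
      prodV-++ Vec.[] ys = sym (ℕP.+-identityʳ _)
      prodV-++ (x Vec.∷ xs) ys = trans (cong (x *_) (prodV-++ xs ys)) (sym (ℕP.*-assoc x _ _))
      prodV-ones : ∀ k → prodV (Vec.map _! (Vec.replicate k 1)) ≡ 1
      prodV-ones zero = refl
      prodV-ones (suc k) = trans (ℕP.+-identityʳ _) (prodV-ones k)

  colour-cases : ∀ r (P : Fin (suc r + suc r) → Set) → (∀ i b → P (colour r (toℕ i) b)) → ∀ c → P c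
  colour-cases r P case c = subst P (FinP.join-splitAt (suc r) (suc r) c) (by-half (Fin.splitAt (suc r) c))
    where
      by-half : ∀ s → P (Fin.join (suc r) (suc r) s)
      by-half (inj₁ i) = subst P (cong (_↑ˡ suc r) (clamp-toℕ r i)) (case i false)
      by-half (inj₂ i) = subst P (cong (suc r ↑ʳ_) (clamp-toℕ r i)) (case i true)

  lookup-colourClassSizes : ∀ {r} (ns : Vec ℕ (suc r)) i b
    → lookup (colourClassSizes ns) (colour r (toℕ i) b) ≡ (if b then 1 else lookup ns i ∸ 1)
  lookup-colourClassSizes {r} ns i false = begin
    lookup (colourClassSizes ns) (clamp r (toℕ i) ↑ˡ suc r) ≡⟨ cong (λ j → lookup (colourClassSizes ns) (j ↑ˡ suc r)) (clamp-toℕ r i) ⟩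
    lookup (colourClassSizes ns) (i ↑ˡ suc r)               ≡⟨ VecP.lookup-++ˡ (Vec.map (_∸ 1) ns) _ i ⟩
    lookup (Vec.map (_∸ 1) ns) i                            ≡⟨ VecP.lookup-map i (_∸ 1) ns ⟩
    lookup ns i ∸ 1                                         ∎
    where open ≡-Reasoning
  lookup-colourClassSizes {r} ns i true = begin
    lookup (colourClassSizes ns) (suc r ↑ʳ clamp r (toℕ i)) ≡⟨ cong (λ j → lookup (colourClassSizes ns) (suc r ↑ʳ j)) (clamp-toℕ r i) ⟩
    lookup (colourClassSizes ns) (suc r ↑ʳ i)               ≡⟨ VecP.lookup-++ʳ (Vec.map (_∸ 1) ns) _ i ⟩
    lookup (Vec.replicate (suc r) 1) i                      ≡⟨ VecP.lookup-replicate i 1 ⟩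
    1                                                       ∎
    where open ≡-Reasoning

  classSize-colour : ∀ {M} r (f : Fin M → ℕ) (g : Fin M → Bool) → (∀ x → f x ≤ r) → ∀ (i : Fin (suc r)) b
    → classSize (λ x → colour r (f x) (g x)) (colour r (toℕ i) b)
      ≡ countF (λ x → ⌊ f x ℕ.≟ toℕ i ⌋ ∧ (if b then g x else not (g x)))
  classSize-colour r f g bounded i b = countF-cong _ _ (λ x →
    trans (colour-≟ r (f x) (toℕ i) (g x) b (bounded x) (ℕ.s≤s⁻¹ (FinP.toℕ<n i)))
          (cong (⌊ f x ℕ.≟ toℕ i ⌋ ∧_) (≟-as-if (g x) b)))

  colourClassSizes-from-counts : ∀ {M} r (ns : Vec ℕ (suc r)) (f : Fin M → ℕ) (g : Fin M → Bool)
    → (∀ x → f x ≤ r)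
    → (∀ i → countF (λ x → ⌊ f x ℕ.≟ toℕ i ⌋ ∧ g x) ≡ 1)
    → (∀ i → countF (λ x → ⌊ f x ℕ.≟ toℕ i ⌋ ∧ not (g x)) ≡ lookup ns i ∸ 1)
    → ∀ c → classSize (λ x → colour r (f x) (g x)) c ≡ lookup (colourClassSizes ns) c
  colourClassSizes-from-counts r ns f g bounded flagged unflagged = colour-cases r _ λ i b →
    trans (classSize-colour r f g bounded i b) (trans (by-flag i b) (sym (lookup-colourClassSizes ns i b)))
    where
      by-flag : ∀ i b → countF (λ x → ⌊ f x ℕ.≟ toℕ i ⌋ ∧ (if b then g x else not (g x))) ≡ (if b then 1 else lookup ns i ∸ 1)
      by-flag i false = unflagged i
      by-flag i true = flagged i

  last-lookup : ∀ {A : Set} {r} (xs : Vec A (suc r)) → Vec.last xs ≡ lookup xs (Fin.fromℕ r)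
  last-lookup (x Vec.∷ Vec.[]) = refl
  last-lookup (x Vec.∷ y Vec.∷ ys) = last-lookup (y Vec.∷ ys)

  points-to : ∀ {k} → Maybe (Fin k) → Fin k → Bool
  points-to nothing _ = false
  points-to (just u) v = ⌊ v Fin.≟ u ⌋

  module DoubleCounting (S : ℤ → Set) (m : ℤ) (max-step : ∀ s → S s → s ℤ.≤ ℤ.+ 1)
                        (r : ℕ) (ns : Vec ℕ (suc r)) (D : VType m → ℕ) where
    open VertexSet ns

    n N K : ℕ
    n = Vec.sum ns
    N = Vsize ns
    K = suc r + suc r

    isFirst : Fin N → Bool
    isFirst x = ⌊ proj₂ (label ns x) ℕ.≟ 1 ⌋

    colourV : Fin N → Fin K
    colourV x = colour r (level ns x) (isFirst x)

    distinguished : (ρ : Fin n) (par : Fin n → Fin n) (a : Fin n → ℕ) (q : Fin n) → ℕ → Fin n → Bool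
    distinguished ρ par a q zero v = ⌊ v Fin.≟ ρ ⌋
    distinguished ρ par a q (suc i) v = points-to (predOfFirst a i (pathTo ρ par N q)) v

    colourT : RawCayley n → Fin n → Fin n → Fin K
    colourT (ρ , pv , av) q v = colour r (lookup av v) (distinguished ρ (lookup pv) (lookup av) q (lookup av v) v)

    Marking : RawCayley n → Fin n × Vec (Fin N) n → Set
    Marking T@(_ , _ , av) (q , σ) = ⌊ lookup av q ℕ.≟ r ⌋ ≡ true × ColourMatching (colourT T q) colourV σ

    module OnCayleyTree (ρ : Fin n) (pv : Vec (Fin n) n) (av : Vec ℕ n) (T : IsCayley S m r ns D (ρ , pv , av)) where
      par : Fin n → Fin n
      par = lookup pv
      a : Fin n → ℕ
      a = lookup av

      rooted : Tree.IsRootedTree ρ par a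
      rooted = proj₁ T
      root-level : a ρ ≡ 0
      root-level = proj₁ (proj₂ T)
      steps : Tree.StepsIn ρ par a S
      steps = proj₁ (proj₂ (proj₂ T))
      bounded : ∀ v → a v ≤ r
      bounded = proj₁ (proj₂ (proj₂ (proj₂ T)))
      profile : ∀ (i : Fin (suc r)) → countF (λ v → ⌊ a v ℕ.≟ toℕ i ⌋) ≡ lookup ns i
      profile = proj₁ (proj₂ (proj₂ (proj₂ (proj₂ T))))
      typeDist : Tree.HasTypeDist ρ par a m D
      typeDist = proj₂ (proj₂ (proj₂ (proj₂ (proj₂ T))))

      step-up : ∀ v → v ≢ ρ → a v ≤ suc (a (par v))
      step-up v v≢ρ = step≤1 _ _ (max-step _ (steps v v≢ρ))

      open Descent ρ par a root-level step-up

      -- rootedness with fuel N = |V|, the fuel used by the paths on both sides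
      reaches-root : ∀ v → iter par N v ≡ ρ
      reaches-root v = subst (λ k → iter par k v ≡ ρ) (sym Vsize≡n) (proj₂ rooted v)

      module Marked (q : Fin n) (q-top : a q ≡ r) where
        isDistinguished : Fin n → Bool
        isDistinguished v = distinguished ρ par a q (a v) v

        descent : ∀ i → i < r → Σ (Fin n) λ u → predOfFirst a i (pathTo ρ par N q) ≡ just u × a u ≡ suc i
        descent i i<r = first-descent N q (reaches-root q) i (subst (suc i ≤_) (sym q-top) i<r)

        distinguishedVertex : Fin (suc r) → Fin n
        distinguishedVertex zero = ρ
        distinguishedVertex (suc j) = proj₁ (descent (toℕ j) (FinP.toℕ<n j))

        root-distinguished : isDistinguished ρ ≡ true
        root-distinguished rewrite root-level = ⌊⌋-complete (ρ Fin.≟ ρ) refl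

        descent-distinguished : ∀ i i<r → isDistinguished (proj₁ (descent i i<r)) ≡ true
        descent-distinguished i i<r with descent i i<r
        ... | u , found , au rewrite au | found = ⌊⌋-complete (u Fin.≟ u) refl

        distinguishedVertex-sat : ∀ i → (⌊ a (distinguishedVertex i) ℕ.≟ toℕ i ⌋ ∧ isDistinguished (distinguishedVertex i)) ≡ true
        distinguishedVertex-sat zero = cong₂ _∧_ (⌊⌋-complete (a ρ ℕ.≟ 0) root-level) root-distinguished
        distinguishedVertex-sat (suc j) = cong₂ _∧_
          (⌊⌋-complete (a (distinguishedVertex (suc j)) ℕ.≟ suc (toℕ j)) (proj₂ (proj₂ (descent (toℕ j) (FinP.toℕ<n j)))))
          (descent-distinguished (toℕ j) (FinP.toℕ<n j))

        distinguishedVertex-unique : ∀ i v → a v ≡ toℕ i → isDistinguished v ≡ true → v ≡ distinguishedVertex i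
        distinguishedVertex-unique zero v av≡0 dist =
          ⌊⌋-sound (v Fin.≟ ρ) (subst (λ ℓ → distinguished ρ par a q ℓ v ≡ true) av≡0 dist)
        distinguishedVertex-unique (suc j) v av≡ dist with descent (toℕ j) (FinP.toℕ<n j)
        ... | u , found , _ = ⌊⌋-sound (v Fin.≟ u)
          (subst (λ o → points-to o v ≡ true) found (subst (λ ℓ → distinguished ρ par a q ℓ v ≡ true) av≡ dist))

        distinguished-unique : ∀ i v → (⌊ a v ℕ.≟ toℕ i ⌋ ∧ isDistinguished v) ≡ ⌊ v Fin.≟ distinguishedVertex i ⌋
        distinguished-unique i v = Bool-ext _ _
          (λ h → let (level-i , dist) = ∧-true h in ⌊⌋-complete (v Fin.≟ distinguishedVertex i)
                   (distinguishedVertex-unique i v (⌊⌋-sound (a v ℕ.≟ toℕ i) level-i) dist))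
          (λ h → subst (λ w → (⌊ a w ℕ.≟ toℕ i ⌋ ∧ isDistinguished w) ≡ true)
                   (sym (⌊⌋-sound (v Fin.≟ distinguishedVertex i) h)) (distinguishedVertex-sat i))

        count-distinguished : ∀ i → countF (λ v → ⌊ a v ℕ.≟ toℕ i ⌋ ∧ isDistinguished v) ≡ 1
        count-distinguished i = trans (countF-cong _ _ (distinguished-unique i)) (countF-single (distinguishedVertex i))

        level-split : ∀ i → lookup ns i ≡ 1 + countF (λ v → ⌊ a v ℕ.≟ toℕ i ⌋ ∧ not (isDistinguished v))
        level-split i = begin
          lookup ns i
            ≡⟨ sym (profile i) ⟩
          countF (λ v → ⌊ a v ℕ.≟ toℕ i ⌋)
            ≡⟨ countF-split (λ v → ⌊ a v ℕ.≟ toℕ i ⌋) isDistinguished ⟩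
          countF (λ v → ⌊ a v ℕ.≟ toℕ i ⌋ ∧ isDistinguished v) + countF (λ v → ⌊ a v ℕ.≟ toℕ i ⌋ ∧ not (isDistinguished v))
            ≡⟨ cong (_+ countF (λ v → ⌊ a v ℕ.≟ toℕ i ⌋ ∧ not (isDistinguished v))) (count-distinguished i) ⟩
          1 + countF (λ v → ⌊ a v ℕ.≟ toℕ i ⌋ ∧ not (isDistinguished v)) ∎
          where open ≡-Reasoning

        level-inhabited : ∀ i → 1 ≤ lookup ns i
        level-inhabited i = subst (1 ≤_) (sym (level-split i)) (s≤s z≤n)

        matchings : Enumeration (ColourMatching (colourT (ρ , pv , av) q) colourV) (factorialProduct (colourClassSizes ns))
        matchings = count-matchings n _ colourV (colourClassSizes ns)
          (colourClassSizes-from-counts r ns a isDistinguished bounded count-distinguished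
            (λ i → cong (_∸ 1) (sym (level-split i))))
          (colourClassSizes-from-counts r ns (level ns) isFirst level-bound
            (λ i → count-first i (level-inhabited i)) count-not-first)

      marks : Enumeration (λ q → ⌊ a q ℕ.≟ r ⌋ ≡ true) (Vec.last ns)
      marks = enumeration-resize
        (trans (countF-cong _ _ (λ v → cong (λ z → ⌊ a v ℕ.≟ z ⌋) (sym (FinP.toℕ-fromℕ r))))
               (trans (profile (Fin.fromℕ r)) (sym (last-lookup ns))))
        (countF-enumeration (λ q → ⌊ a q ℕ.≟ r ⌋))

      markings : Enumeration (Marking (ρ , pv , av)) (Vec.last ns * factorialProduct (colourClassSizes ns))
      markings = enumeration-Σ marks (λ q q-top → Marked.matchings q (⌊⌋-sound (a q ℕ.≟ r) q-top))

    CayleyTriple : RawCayley n × (Fin n × Vec (Fin N) n) → Set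
    CayleyTriple (T , μ) = IsCayley S m r ns D T × Marking T μ

    cayleyTriples : ∀ {k₁} → HasCard (IsCayley S m r ns D) k₁
      → Enumeration CayleyTriple (k₁ * (Vec.last ns * factorialProduct (colourClassSizes ns)))
    cayleyTriples cayleys = enumeration-Σ (hasCard⇒enumeration cayleys)
      (λ { (ρ , pv , av) T → OnCayleyTree.markings ρ pv av T })

    -- B: marked S-trees on V with (T), together with an arbitrary injection
    -- Fin n → V (a colour matching for the trivial one-colour colouring)
    MarkedPair : RawMarked N × Vec (Fin N) n → Set
    MarkedPair (T′ , τ) = IsMarkedT S m r ns D T′ × ColourMatching {K = 1} (λ _ → zero) (λ _ → zero) τ

    markedPairs : ∀ {k₂} → HasCard (IsMarkedT S m r ns D) k₂
      → Enumeration MarkedPair (k₂ * factorialProduct (n Vec.∷ Vec.[]))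
    markedPairs marked = enumeration-Σ (hasCard⇒enumeration marked) (λ _ _ →
      count-matchings n (λ _ → zero) (λ _ → zero) (n Vec.∷ Vec.[])
        (λ { zero → countF-all n }) (λ { zero → trans (countF-all N) Vsize≡n }))

    forward : ∀ z → CayleyTriple z → RawMarked N × Vec (Fin N) n
    forward ((ρ , pv , av) , (q , σ)) _ =
      (lookup σ ρ , tabulate (λ y → lookup σ (lookup pv (inverse Vsize≡n σ y))) , lookup σ q) , σ

    backward : ∀ z → MarkedPair z → RawCayley n × (Fin n × Vec (Fin N) n)
    backward ((ρ′ , pv′ , q′) , τ) _ =
      ( inverse Vsize≡n τ ρ′
      , tabulate (λ v → inverse Vsize≡n τ (lookup pv′ (lookup τ v)))
      , tabulate (λ v → level ns (lookup τ v)) ) ,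
      (inverse Vsize≡n τ q′ , τ)

    module Forward (ρ : Fin n) (pv : Vec (Fin n) n) (av : Vec ℕ n) (q : Fin n) (σ : Vec (Fin N) n)
                   (T : IsCayley S m r ns D (ρ , pv , av)) (q-top : ⌊ lookup av q ℕ.≟ r ⌋ ≡ true)
                   (σ-inj : IsInjection σ) (σ-col : PreservesColour (colourT (ρ , pv , av) q) colourV σ) where
      open OnCayleyTree ρ pv av T
      open Marked q (⌊⌋-sound (a q ℕ.≟ r) q-top)

      σf : Fin n → Fin N
      σf = lookup σ
      σ⁻¹ : Fin N → Fin n
      σ⁻¹ = inverse Vsize≡n σ
      par′ : Fin N → Fin N
      par′ = lookup (tabulate (λ y → σf (par (σ⁻¹ y))))

      σ-colour : ∀ v → level ns (σf v) ≡ a v × isFirst (σf v) ≡ isDistinguished v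
      σ-colour v = colour-injective r _ _ _ _ (level-bound (σf v)) (bounded v) (σ-col v)

      σ-level : ∀ v → level ns (σf v) ≡ a v
      σ-level v = proj₁ (σ-colour v)

      σ-par : ∀ v → par′ (σf v) ≡ σf (par v)
      σ-par v = trans (VecP.lookup∘tabulate _ (σf v)) (cong (σf ∘ par) (inverse-left Vsize≡n σ σ-inj v))

      module R = Relabelling σf σ⁻¹ (inverse-left Vsize≡n σ σ-inj) (inverse-right Vsize≡n σ σ-inj)
                   ρ par a (σf ρ) par′ (level ns) refl σ-par σ-level

      distinguished⇒first : ∀ v → isDistinguished v ≡ true → label ns (σf v) ≡ (a v , 1)
      distinguished⇒first v dist = cong₂ _,_ (σ-level v)
        (⌊⌋-sound (proj₂ (label ns (σf v)) ℕ.≟ 1) (trans (proj₂ (σ-colour v)) dist))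

      condition-T : ∀ (i : ℕ) → 1 ≤ i → i ≤ r → Σ (Fin N) λ u →
        predOfFirst (level ns) (i ∸ 1) (pathTo (σf ρ) par′ N (σf q)) ≡ just u × label ns u ≡ (i , 1)
      condition-T (suc i) _ i<r with descent i i<r | descent-distinguished i i<r
      ... | u , found , au | dist = σf u ,
        trans (cong (predOfFirst (level ns) i) (R.σ-pathTo N q))
              (trans (R.σ-predOfFirst i (pathTo ρ par N q)) (cong (Maybe.map σf) found)) ,
        trans (distinguished⇒first u dist) (cong (_, 1) au)

      marked-pair : MarkedPair (forward ((ρ , pv , av) , (q , σ)) (T , q-top , σ-inj , σ-col))
      marked-pair =
        ( trans (distinguished⇒first ρ root-distinguished) (cong (_, 1) root-level)
        , R.rooted (sym Vsize≡n) rooted , R.steps S steps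
        , trans (σ-level q) (⌊⌋-sound (a q ℕ.≟ r) q-top) , condition-T , R.typeDist m D typeDist )
        , σ-inj , (λ _ → refl)

    module Backward (ρ′ : Fin N) (pv′ : Vec (Fin N) N) (q′ : Fin N) (τ : Vec (Fin N) n)
                    (T′ : IsMarkedT S m r ns D (ρ′ , pv′ , q′)) (τ-inj : IsInjection τ) where
      τf : Fin n → Fin N
      τf = lookup τ
      τ⁻¹ : Fin N → Fin n
      τ⁻¹ = inverse Vsize≡n τ
      par′ : Fin N → Fin N
      par′ = lookup pv′

      root-label : label ns ρ′ ≡ (0 , 1)
      root-label = proj₁ T′
      rooted′ : Tree.IsRootedTree ρ′ par′ (level ns)
      rooted′ = proj₁ (proj₂ T′)
      steps′ : Tree.StepsIn ρ′ par′ (level ns) S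
      steps′ = proj₁ (proj₂ (proj₂ T′))
      q′-top : level ns q′ ≡ r
      q′-top = proj₁ (proj₂ (proj₂ (proj₂ T′)))
      condition-T : ∀ (i : ℕ) → 1 ≤ i → i ≤ r → Σ (Fin N) λ u →
        predOfFirst (level ns) (i ∸ 1) (pathTo ρ′ par′ N q′) ≡ just u × label ns u ≡ (i , 1)
      condition-T = proj₁ (proj₂ (proj₂ (proj₂ (proj₂ T′))))
      typeDist′ : Tree.HasTypeDist ρ′ par′ (level ns) m D
      typeDist′ = proj₂ (proj₂ (proj₂ (proj₂ (proj₂ T′))))

      ρ₁ : Fin n
      ρ₁ = τ⁻¹ ρ′
      pv₁ : Vec (Fin n) n
      pv₁ = tabulate (λ v → τ⁻¹ (par′ (τf v)))
      av₁ : Vec ℕ n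
      av₁ = tabulate (λ v → level ns (τf v))
      q₁ : Fin n
      q₁ = τ⁻¹ q′

      a₁-def : ∀ v → lookup av₁ v ≡ level ns (τf v)
      a₁-def v = VecP.lookup∘tabulate _ v

      τ⁻¹-par : ∀ x → lookup pv₁ (τ⁻¹ x) ≡ τ⁻¹ (par′ x)
      τ⁻¹-par x = trans (VecP.lookup∘tabulate _ (τ⁻¹ x)) (cong (τ⁻¹ ∘ par′) (inverse-right Vsize≡n τ τ-inj x))

      τ⁻¹-level : ∀ x → lookup av₁ (τ⁻¹ x) ≡ level ns x
      τ⁻¹-level x = trans (a₁-def (τ⁻¹ x)) (cong (level ns) (inverse-right Vsize≡n τ τ-inj x))

      module R = Relabelling τ⁻¹ τf (inverse-right Vsize≡n τ τ-inj) (inverse-left Vsize≡n τ τ-inj)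
                   ρ′ par′ (level ns) ρ₁ (lookup pv₁) (lookup av₁) refl τ⁻¹-par τ⁻¹-level

      first-iff : ∀ v w ℓ → level ns (τf v) ≡ ℓ → label ns w ≡ (ℓ , 1) → isFirst (τf v) ≡ ⌊ v Fin.≟ τ⁻¹ w ⌋
      first-iff v w ℓ τv-level w-label = Bool-ext _ _
        (λ first → ⌊⌋-complete (v Fin.≟ τ⁻¹ w) (trans (sym (inverse-left Vsize≡n τ τ-inj v)) (cong τ⁻¹
          (label-injective _ _ (trans (cong₂ _,_ τv-level (⌊⌋-sound (proj₂ (label ns (τf v)) ℕ.≟ 1) first)) (sym w-label))))))
        (λ v≡ → ⌊⌋-complete (proj₂ (label ns (τf v)) ℕ.≟ 1) (trans (cong (proj₂ ∘ label ns)
          (trans (cong τf (⌊⌋-sound (v Fin.≟ τ⁻¹ w) v≡)) (inverse-right Vsize≡n τ τ-inj w))) (cong proj₂ w-label)))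

      -- condition (T) says: the first vertices are exactly the images of the distinguished ones
      first⇔distinguished : ∀ ℓ v → level ns (τf v) ≡ ℓ
        → isFirst (τf v) ≡ distinguished ρ₁ (lookup pv₁) (lookup av₁) q₁ ℓ v
      first⇔distinguished zero v τv-level = first-iff v ρ′ 0 τv-level root-label
      first⇔distinguished (suc i) v τv-level with condition-T (suc i) (s≤s z≤n) (subst (_≤ r) τv-level (level-bound (τf v)))
      ... | u , found , u-label = trans (first-iff v u (suc i) τv-level u-label) (cong (λ o → points-to o v) (sym found₁))
        where
          found₁ : predOfFirst (lookup av₁) i (pathTo ρ₁ (lookup pv₁) N q₁) ≡ just (τ⁻¹ u)
          found₁ = trans (cong (predOfFirst (lookup av₁) i) (R.σ-pathTo N q′))
                         (trans (R.σ-predOfFirst i (pathTo ρ′ par′ N q′)) (cong (Maybe.map τ⁻¹) found))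

      τ-col : PreservesColour (colourT (ρ₁ , pv₁ , av₁) q₁) colourV τ
      τ-col v = cong₂ (colour r) (sym (a₁-def v))
        (trans (first⇔distinguished (level ns (τf v)) v refl)
               (cong (λ ℓ → distinguished ρ₁ (lookup pv₁) (lookup av₁) q₁ ℓ v) (sym (a₁-def v))))

      cayley-triple : CayleyTriple (backward ((ρ′ , pv′ , q′) , τ) (T′ , τ-inj , (λ _ → refl)))
      cayley-triple =
        ( R.rooted Vsize≡n rooted′ , trans (τ⁻¹-level ρ′) (cong proj₁ root-label) , R.steps S steps′
        , R.bound r level-bound , (λ i → trans (R.profile (toℕ i)) (level-profile i)) , R.typeDist m D typeDist′ )
        , ⌊⌋-complete (lookup av₁ q₁ ℕ.≟ r) (trans (τ⁻¹-level q′) q′-top) , τ-inj , τ-col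

    backward∘forward : ∀ z p y p′ → forward z p ≡ y → backward y p′ ≡ z
    backward∘forward ((ρ , pv , av) , (q , σ)) (T , q-top , σ-inj , σ-col) _ _ refl =
      cong₂ _,_ (cong₂ _,_ (σ⁻¹∘σ ρ) (cong₂ _,_ parents levels)) (cong₂ _,_ (σ⁻¹∘σ q) refl)
      where
        σ⁻¹∘σ : ∀ v → inverse Vsize≡n σ (lookup σ v) ≡ v
        σ⁻¹∘σ = inverse-left Vsize≡n σ σ-inj
        parents : tabulate (λ v → inverse Vsize≡n σ (lookup (tabulate (λ y → lookup σ (lookup pv (inverse Vsize≡n σ y))))
                                                            (lookup σ v))) ≡ pv
        parents = trans (VecP.tabulate-cong (λ v → trans (cong (inverse Vsize≡n σ) (VecP.lookup∘tabulate _ (lookup σ v)))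
                    (trans (σ⁻¹∘σ _) (cong (lookup pv) (σ⁻¹∘σ v))))) (VecP.tabulate∘lookup pv)
        levels : tabulate (λ v → level ns (lookup σ v)) ≡ av
        levels = trans (VecP.tabulate-cong (Forward.σ-level ρ pv av q σ T q-top σ-inj σ-col)) (VecP.tabulate∘lookup av)

    forward∘backward : ∀ y p′ z p → backward y p′ ≡ z → forward z p ≡ y
    forward∘backward ((ρ′ , pv′ , q′) , τ) (T′ , τ-inj , _) _ _ refl =
      cong₂ _,_ (cong₂ _,_ (τ∘τ⁻¹ ρ′) (cong₂ _,_ parents (τ∘τ⁻¹ q′))) refl
      where
        τ∘τ⁻¹ : ∀ x → lookup τ (inverse Vsize≡n τ x) ≡ x
        τ∘τ⁻¹ = inverse-right Vsize≡n τ τ-inj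
        parents : tabulate (λ y → lookup τ (lookup (tabulate (λ v → inverse Vsize≡n τ (lookup pv′ (lookup τ v))))
                                                   (inverse Vsize≡n τ y))) ≡ pv′
        parents = trans (VecP.tabulate-cong (λ y → trans (cong (lookup τ) (VecP.lookup∘tabulate _ (inverse Vsize≡n τ y)))
                    (trans (τ∘τ⁻¹ _) (cong (lookup pv′) (τ∘τ⁻¹ y))))) (VecP.tabulate∘lookup pv′)

    double-count : ∀ {k₁ k₂} → HasCard (IsCayley S m r ns D) k₁ → HasCard (IsMarkedT S m r ns D) k₂
      → k₁ * (Vec.last ns * factorialProduct (colourClassSizes ns)) ≡ k₂ * factorialProduct (n Vec.∷ Vec.[])
    double-count cayleys marked = enumeration-unique
      (enumeration-transport forward backward
        (λ { ((ρ , pv , av) , (q , σ)) (T , q-top , σ-inj , σ-col) → Forward.marked-pair ρ pv av q σ T q-top σ-inj σ-col })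
        (λ { ((ρ′ , pv′ , q′) , τ) (T′ , τ-inj , _) → Backward.cayley-triple ρ′ pv′ q′ τ T′ τ-inj })
        backward∘forward forward∘backward (cayleyTriples cayleys))
      (markedPairs marked)

open import Defs
open import Data.Nat using (ℕ; suc; _*_; _∸_)
open import Data.Nat using (_!)
open import Data.Integer using (ℤ; _≤_; +_)
open import Data.Vec using (Vec; sum; last; map)
open import Relation.Binary.PropositionalEquality using (_≡_; cong; sym; module ≡-Reasoning)
import Data.Nat.Properties as ℕP
open Counting using (module DoubleCounting; factorialProduct; colourClassSizes; factorialProduct-colourClassSizes)

lemma4p1 : (S : ℤ → Set) (m : ℤ)
    → S (+ 1) → (∀ s → S s → s ≤ + 1)
    → S m → (∀ s → S s → m ≤ s)
    → (r : ℕ) (ns : Vec ℕ (suc r)) (D : VType m → ℕ) (k₁ k₂ : ℕ)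
    → HasCard (IsCayley S m r ns D) k₁
    → HasCard (IsMarkedT S m r ns D) k₂
    → last ns * prodV (map (λ x → (x ∸ 1) !) ns) * k₁ ≡ (sum ns) ! * k₂
lemma4p1 S m _ max-step _ _ r ns D k₁ k₂ cayleys marked = begin
  last ns * prodV (map (λ x → (x ∸ 1) !) ns) * k₁
    ≡⟨ ℕP.*-comm _ k₁ ⟩
  k₁ * (last ns * prodV (map (λ x → (x ∸ 1) !) ns))
    ≡⟨ cong (λ p → k₁ * (last ns * p)) (sym (factorialProduct-colourClassSizes ns)) ⟩
  k₁ * (last ns * factorialProduct (colourClassSizes ns))
    ≡⟨ DoubleCounting.double-count S m max-step r ns D cayleys marked ⟩
  k₂ * ((sum ns) ! * 1)
    ≡⟨ cong (k₂ *_) (ℕP.*-identityʳ _) ⟩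
  k₂ * (sum ns) !
    ≡⟨ ℕP.*-comm k₂ _ ⟩
  (sum ns) ! * k₂ ∎
  where open ≡-Reasoning
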